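{- Let $\pi:{\bf MR}\to{\bf Sym}$ be the algebra morphism $F\mapsto F|_{\bar A=A}$, sending $S_n\mapsto S_n$ and $S_{\bar n}\mapsto S_n$. Then $$\pi(\zeta_n)=\begin{cases}\zeta^{(2)}_n, & n\text{ odd},\\ 0, & n\text{ even},\end{cases}\qquad \pi(\tilde\zeta_n)=\begin{cases}0, & n\text{ odd},\\ \zeta^{(2)}_n, & n\text{ even}.\end{cases}$$ In particular, if $I=(i_0,i_1,\dots,i_p)$ is a type $B$ composition, then $\pi(e_I)=e^{(2)}_I$ if $I$ is a $2$-peak composition, and $\pi(e_I)=0$ otherwise.
   Context: Work over $\mathbb{Q}$. ${\bf Sym}$: free associative algebra on $S_1,S_2,\dots$ ($\deg S_n=n$, $S_0=1$); $\sigma_1:=\sum_nS_n$. ${\bf MR}$: free associative algebra on $S_n,S_{\bar n}$ ($n\ge1$), $\deg S_n=\deg S_{\bar n}=n$, $S_0=S_{\bar0}=1$; $F\mapsto\bar F$ is the involutive anti-automorphism exchanging $S_n$ and $S_{\bar n}$. $\Lambda_n$: $\sum\Lambda_nt^n=(\sum S_n(-t)^n)^{ -1}$; $\Lambda_{\bar n}:=\overline{\Lambda_n}$; $\bar\lambda_1:=\sum_n\Lambda_{\bar n}$; $\sigma_1^\sharp:=\bar\lambda_1\sigma_1$. Elements $\zeta_n\in{\bf MR}$ ($\deg n\ge1$) are defined by $\sigma_1^\sharp=(e^{\zeta_1}e^{\zeta_2}e^{\zeta_3}\cdots)(\cdots e^{\zeta_3}e^{\zeta_2}e^{\zeta_1})$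 and $\tilde\zeta_n$ ($n\ge0$, $\tilde\zeta_0=1$) by $\sigma_1=(\sum_n\tilde\zeta_n)(\cdots e^{\zeta_3}e^{\zeta_2}e^{\zeta_1})$. The elements $\zeta^{(2)}_n\in{\bf Sym}_n$ ($\zeta^{(2)}_0=1$) are uniquely defined by $\sigma_1=(\sum_{p\ge0}\zeta^{(2)}_{2p})\cdots e^{\zeta^{(2)}_5}e^{\zeta^{(2)}_3}e^{\zeta^{(2)}_1}$ (product over odd indices, decreasing from left to right). A type $B$ composition is $I=(i_0,i_1,\dots,i_p)$ with $i_0\ge0$, $i_1,\dots,i_p\ge1$; it is a $2$-peak composition if $i_0$ is even and $i_1,\dots,i_p$ are odd. With $\bar I:=(i_1,\dots,i_p)$ and $m_{\bar I}:=\prod_jm_j!$ ($m_j$ = multiplicity of $j$ in $\bar I$): $e_I:=\frac1{m_{\bar I}}\tilde\zeta_{i_0}\zeta_{i_1}\cdots\zeta_{i_p}$ and $e^{(2)}_I:=\frac1{m_{\bar I}}\zeta^{(2)}_{i_0}\zeta^{(2)}_{i_1}\cdots\zeta^{(2)}_{i_p}$. -}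

module Defs where

open import Data.Nat as ℕ using (ℕ; zero; suc; _!; _∸_; _≤ᵇ_; _≡ᵇ_; _%_)
open import Data.Nat.Properties using (_!≢0)
open import Data.Integer using (+_)
open import Data.Rational as ℚ using (ℚ; 0ℚ; 1ℚ)
open import Data.Bool using (Bool; true; false; if_then_else_; not; _∧_)
open import Data.List.Relation.Unary.All using (All)
import Data.Bool.Properties as BoolP
open import Data.List as L using (List; []; _∷_; _++_; map; concatMap; foldr; reverse; upTo; zip; filter; length)
open import Data.Bool.ListAction using (and)
import Data.List.Properties as ListP
open import Data.Product using (_×_; _,_; proj₁; proj₂)
import Data.Product.Properties as ProdP
open import Relation.Binary.Definitions using (DecidableEquality)
open import Relation.Binary.PropositionalEquality using (_≡_)
open import Relation.Nullary using (¬_; does)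
import Data.Nat.Properties as NP
import Data.Nat.ListAction as NLA

invFact : ℕ → ℚ
invFact m = (+ 1 ℚ./ (m !)) {{m !≢0}}

oneTo : ℕ → List ℕ
oneTo n = map suc (upTo n)

-- A polynomial is a finite formal ℚ-linear combination of words; two
-- polynomials are equal (≈) iff all their word coefficients agree.

module Poly {A : Set} (_≟A_ : DecidableEquality A) (wt : A → ℕ) where

  Word : Set
  Word = List A

  _≟W_ : DecidableEquality Word
  _≟W_ = ListP.≡-dec _≟A_

  Pol : Set
  Pol = List (ℚ × Word)

  deg : Word → ℕ
  deg w = NLA.sum (map wt w)

  coeff : Pol → Word → ℚ
  coeff p w = foldr (λ t acc → if does (proj₂ t ≟W w) then proj₁ t ℚ.+ acc else acc) 0ℚ p

  _≈_ : Pol → Pol → Set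
  p ≈ q = ∀ w → coeff p w ≡ coeff q w

  zeroP : Pol
  zeroP = []

  oneP : Pol
  oneP = (1ℚ , []) ∷ []

  letter : A → Pol
  letter a = (1ℚ , a ∷ []) ∷ []

  _⊕_ : Pol → Pol → Pol
  p ⊕ q = p ++ q

  _·_ : ℚ → Pol → Pol
  c · p = map (λ t → (c ℚ.* proj₁ t , proj₂ t)) p

  neg : Pol → Pol
  neg p = (ℚ.- 1ℚ) · p

  _⊗_ : Pol → Pol → Pol
  p ⊗ q = concatMap (λ s → map (λ t → (proj₁ s ℚ.* proj₁ t , proj₂ s ++ proj₂ t)) q) p

  sumP : List Pol → Pol
  sumP = foldr _⊕_ zeroP

  prodP : List Pol → Pol
  prodP = foldr _⊗_ oneP

  powP : Pol → ℕ → Pol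
  powP p zero = oneP
  powP p (suc m) = p ⊗ powP p m

  trunc : ℕ → Pol → Pol
  trunc N p = filter (λ t → deg (proj₂ t) ℕ.≤? N) p

  homPart : ℕ → Pol → Pol
  homPart k p = filter (λ t → deg (proj₂ t) ℕ.≟ k) p

  Homogeneous : ℕ → Pol → Set
  Homogeneous k p = p ≈ homPart k p

  _≈[_]_ : Pol → ℕ → Pol → Set
  p ≈[ N ] q = trunc N p ≈ trunc N q

  -- exp x truncated at x^N (enough for degree ≤ N when x has positive degree)
  expT : ℕ → Pol → Pol
  expT N x = sumP (map (λ m → invFact m · powP x m) (upTo (suc N)))

-- Sym : letters n : ℕ stand for S_{n+1}, of weight n+1.

module SymP = Poly NP._≟_ suc
open SymP public using () renaming (Pol to SymPol)

-- MR : letter (n , false) stands for S_{n+1}, (n , true) for S_{\bar{n+1}}.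
MRLetter : Set
MRLetter = ℕ × Bool

_≟MR_ : DecidableEquality MRLetter
_≟MR_ = ProdP.≡-dec NP._≟_ BoolP._≟_

module MRP = Poly _≟MR_ (λ a → suc (proj₁ a))
open MRP public using () renaming (Pol to MRPol)

S : ℕ → SymPol
S zero = SymP.oneP
S (suc n) = SymP.letter n

SM : ℕ → MRPol
SM zero = MRP.oneP
SM (suc n) = MRP.letter (n , false)

SMbar : ℕ → MRPol
SMbar zero = MRP.oneP
SMbar (suc n) = MRP.letter (n , true)

σ₁ : ℕ → SymPol
σ₁ N = SymP.sumP (map S (upTo (suc N)))

σ₁M : ℕ → MRPol
σ₁M N = MRP.sumP (map SM (upTo (suc N)))

-- The involutive anti-automorphism F ↦ F̄ of MR (exchanging S_n and S_{n̄})
barP : MRPol → MRPol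
barP p = map (λ t → (proj₁ t , reverse (map (λ a → (proj₁ a , not (proj₂ a))) (proj₂ t)))) p

-- Λ_n in MR (in the unbarred letters), from
--   (Σ S_n (-t)^n)(Σ Λ_n t^n) = 1,  i.e.  Λ_0 = 1,
--   Λ_n = - Σ_{k=1}^{n} (-1)^k S_k Λ_{n-k}   (n ≥ 1).
sgn : ℕ → ℚ
sgn k = if does (k % 2 ℕ.≟ 0) then 1ℚ else ℚ.- 1ℚ

-- ΛRev n = [Λ_n , Λ_{n-1} , … , Λ_0]
ΛRev : ℕ → List MRPol
ΛRev zero = MRP.oneP ∷ []
ΛRev (suc n) = new ∷ prev
  where
  prev = ΛRev n
  new = MRP.neg (MRP.sumP (L.zipWith (λ k Λ → sgn k MRP.· (SM k MRP.⊗ Λ)) (oneTo (suc n)) prev))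

headOr : ∀ {X : Set} → X → List X → X
headOr d [] = d
headOr d (x ∷ _) = x

ΛM : ℕ → MRPol
ΛM n = headOr MRP.zeroP (ΛRev n)

Λbar : ℕ → MRPol
Λbar n = barP (ΛM n)

σ₁♯ : ℕ → MRPol
σ₁♯ N = MRP.sumP (map Λbar (upTo (suc N))) MRP.⊗ σ₁M N

π : MRPol → SymPol
π p = map (λ t → (proj₁ t , map proj₁ (proj₂ t))) p

-- Defining properties of ζ_n, ζ̃_n (in MR) and ζ^{(2)}_n (in Sym).
-- Infinite products are checked degree by degree: in degrees ≤ N only the
-- factors of index ≤ N matter.

expsUp : (ℕ → MRPol) → ℕ → MRPol
expsUp ζ N = MRP.prodP (map (λ k → MRP.expT N (ζ k)) (oneTo N))

expsDown : (ℕ → MRPol) → ℕ → MRPol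
expsDown ζ N = MRP.prodP (reverse (map (λ k → MRP.expT N (ζ k)) (oneTo N)))

IsZeta : (ℕ → MRPol) → Set
IsZeta ζ = (∀ n → MRP.Homogeneous (suc n) (ζ (suc n)))
         × (∀ N → σ₁♯ N MRP.≈[ N ] (expsUp ζ N MRP.⊗ expsDown ζ N))

IsZetaTilde : (ℕ → MRPol) → (ℕ → MRPol) → Set
IsZetaTilde ζ ζ̃ = (ζ̃ 0 MRP.≈ MRP.oneP)
         × (∀ n → MRP.Homogeneous n (ζ̃ n))
         × (∀ N → σ₁M N MRP.≈[ N ] (MRP.sumP (map ζ̃ (upTo (suc N))) MRP.⊗ expsDown ζ N))

isEven : ℕ → Bool
isEven n = does (n % 2 ℕ.≟ 0)

IsZeta2 : (ℕ → SymPol) → Set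
IsZeta2 z = (z 0 SymP.≈ SymP.oneP)
         × (∀ n → SymP.Homogeneous n (z n))
         × (∀ N → σ₁ N SymP.≈[ N ]
              (SymP.sumP (map z (filter (λ k → isEven k BoolP.≟ true) (upTo (suc N))))
               SymP.⊗ SymP.prodP (reverse (map (λ k → SymP.expT N (z k))
                                   (filter (λ k → isEven k BoolP.≟ false) (oneTo N))))))

CompB : Set
CompB = ℕ × List ℕ

IsCompB : CompB → Set
IsCompB (i₀ , is) = All (λ i → 1 ℕ.≤ i) is

isTwoPeak : CompB → Bool
isTwoPeak (i₀ , is) = isEven i₀ ∧ and (map (λ i → not (isEven i)) is)

invMult : List ℕ → ℚ
invMult is = foldr ℚ._*_ 1ℚ
  (map (λ j → invFact (length (filter (λ i → i ℕ.≟ j) is))) (oneTo (NLA.sum is)))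

eB : (ℕ → MRPol) → (ℕ → MRPol) → CompB → MRPol
eB ζ ζ̃ (i₀ , is) = invMult is MRP.· (ζ̃ i₀ MRP.⊗ MRP.prodP (map ζ is))

e2B : (ℕ → SymPol) → CompB → SymPol
e2B z (i₀ , is) = invMult is SymP.· (z i₀ SymP.⊗ SymP.prodP (map z is))

module Submission where

-- Work with noncommutative power series (word → ℚ) over the letters of Sym and compare
-- them degree by degree.  Let θ multiply words of degree d by (−1)ᵈ, so θ(σ₁) = σ(−1).  Apply π
-- to σ₁♯ = λ̄₁σ₁: π(λ̄₁) = Σ rev(Λ_n) is the series ε(w) = (−1)^{deg w + ℓ(w)}, computed from the
-- recursion for Λ_n, and ε·θ(σ₁) = 1.  Writing σ₁ = Z·D with Z = Σ ζ⁽²⁾_{2p} and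
-- D = Π↓ e^{ζ⁽²⁾_odd}, we get θ(σ₁) = Z·Π↓ e^{−ζ⁽²⁾_odd}, hence ε·σ₁ = (Π↑ e^{ζ⁽²⁾_odd})·D.
-- Both this and the image of the defining factorisation of σ₁♯ are symmetric factorisations
-- (Π↑ e^{w_k})(Π↓ e^{w_k}) with w_k homogeneous of degree k, and such factorisations are unique:
-- this gives π(ζ_n).  Then σ₁ = π(Σζ̃)·D = Z·D, and cancelling D gives π(ζ̃_n); the statement
-- on e_I follows factor by factor.

open import Defs
open import Data.Nat as ℕ using (ℕ; zero; suc; _≤_; _<_; z≤n; s≤s; _∸_; _%_; _!; NonZero)
import Data.Nat.Properties as NP
import Data.Nat.DivMod as DM
open import Data.Integer as ℤ using (+_)
import Data.Integer.Properties as ℤP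
open import Data.Rational as Q using (ℚ; 0ℚ; 1ℚ)
import Data.Rational.Properties as QP
open import Data.Rational.Unnormalised as U using (mkℚᵘ; *≡*)
import Data.Rational.Unnormalised.Properties as UP
open import Data.Rational.Solver using (module +-*-Solver)
open +-*-Solver
open import Data.Bool using (Bool; true; false; if_then_else_; _∧_; not)
import Data.Bool.Properties as BoolP
open import Data.Bool.ListAction using (and)
open import Data.List as L using (List; []; _∷_; _++_; map; foldr; upTo; reverse; length; filter)
import Data.List.Properties as LP
open import Data.List.Relation.Unary.All as All using (All; []; _∷_)
import Data.List.Relation.Unary.All.Properties as AllP
open import Data.List.Relation.Binary.Pointwise using (Pointwise; []; _∷_)
open import Data.Product using (_×_; _,_; proj₁; proj₂)
open import Data.Empty using (⊥; ⊥-elim)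
open import Function using (_∘_; id)
open import Data.Nat.Induction using (<-rec)
open import Relation.Binary.Definitions using (DecidableEquality)
open import Relation.Binary.PropositionalEquality
open import Relation.Nullary using (yes; no; does; Dec; ¬_)
open import Relation.Nullary.Decidable using (_×-dec_)
open import Algebra.Bundles using (module CommutativeRing)
open import Algebra.Properties.Group (CommutativeRing.+-group QP.+-*-commutativeRing)
  using (∙-cancelʳ; ⁻¹-involutive)

when : Bool → ℚ → ℚ
when b x = if b then x else 0ℚ

when-+ : ∀ b x y → when b x Q.+ when b y ≡ when b (x Q.+ y)
when-+ true x y = refl
when-+ false x y = QP.+-identityˡ 0ℚ

when-0 : ∀ b → when b 0ℚ ≡ 0ℚ
when-0 true = refl
when-0 false = refl

when-yes : ∀ {P : Set} (d : Dec P) → P → ∀ x → when (does d) x ≡ x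
when-yes (yes _) _ x = refl
when-yes (no ¬p) p x = ⊥-elim (¬p p)

when-no : ∀ {P : Set} (d : Dec P) → ¬ P → ∀ x → when (does d) x ≡ 0ℚ
when-no (yes p) ¬p x = ⊥-elim (¬p p)
when-no (no _) _ x = refl

does-⇔ : ∀ {P R : Set} (d : Dec P) (e : Dec R) → (P → R) → (R → P) → does d ≡ does e
does-⇔ (yes p) (yes r) f g = refl
does-⇔ (yes p) (no ¬r) f g = ⊥-elim (¬r (f p))
does-⇔ (no ¬p) (yes r) f g = ⊥-elim (¬p (g r))
does-⇔ (no ¬p) (no ¬r) f g = refl

module Coefficients {A : Set} (_≟A_ : DecidableEquality A) (wt : A → ℕ) where
  open Poly _≟A_ wt

  mono : ℚ → Word → Word → ℚ
  mono c u w = when (does (u ≟W w)) c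

  mono-yes : ∀ c u → mono c u u ≡ c
  mono-yes c u = when-yes (u ≟W u) refl c

  mono-no : ∀ c u w → u ≢ w → mono c u w ≡ 0ℚ
  mono-no c u w ne = when-no (u ≟W w) ne c

  coeff-cons : ∀ c u p w → coeff ((c , u) ∷ p) w ≡ mono c u w Q.+ coeff p w
  coeff-cons c u p w with does (u ≟W w)
  ... | true = refl
  ... | false = sym (QP.+-identityˡ _)

  coeff-++ : ∀ p q w → coeff (p ++ q) w ≡ coeff p w Q.+ coeff q w
  coeff-++ [] q w = sym (QP.+-identityˡ _)
  coeff-++ ((c , u) ∷ p) q w = begin
      coeff ((c , u) ∷ (p ++ q)) w               ≡⟨ coeff-cons c u (p ++ q) w ⟩
      mono c u w Q.+ coeff (p ++ q) w            ≡⟨ cong (mono c u w Q.+_) (coeff-++ p q w) ⟩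
      mono c u w Q.+ (coeff p w Q.+ coeff q w)   ≡⟨ sym (QP.+-assoc (mono c u w) (coeff p w) (coeff q w)) ⟩
      (mono c u w Q.+ coeff p w) Q.+ coeff q w   ≡⟨ cong (Q._+ coeff q w) (sym (coeff-cons c u p w)) ⟩
      coeff ((c , u) ∷ p) w Q.+ coeff q w        ∎
    where open ≡-Reasoning

  coeff-· : ∀ c p w → coeff (c · p) w ≡ c Q.* coeff p w
  coeff-· c [] w = sym (QP.*-zeroʳ c)
  coeff-· c ((d , u) ∷ p) w = begin
      coeff ((c Q.* d , u) ∷ (c · p)) w           ≡⟨ coeff-cons (c Q.* d) u (c · p) w ⟩
      mono (c Q.* d) u w Q.+ coeff (c · p) w      ≡⟨ cong₂ Q._+_ (scale (does (u ≟W w))) (coeff-· c p w) ⟩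
      c Q.* mono d u w Q.+ c Q.* coeff p w        ≡⟨ sym (QP.*-distribˡ-+ c (mono d u w) (coeff p w)) ⟩
      c Q.* (mono d u w Q.+ coeff p w)            ≡⟨ cong (c Q.*_) (sym (coeff-cons d u p w)) ⟩
      c Q.* coeff ((d , u) ∷ p) w                 ∎
    where
    open ≡-Reasoning
    scale : ∀ b → when b (c Q.* d) ≡ c Q.* when b d
    scale true = refl
    scale false = sym (QP.*-zeroʳ c)

  module _ {P : ℕ → Set} (P? : (n : ℕ) → Dec (P n)) where

    private
      test : Word → Bool
      test w = does (P? (deg w))

      mono-kept : ∀ c u w → test u ≡ true → mono c u w ≡ when (test w) (mono c u w)
      mono-kept c u w e with u ≟W w
      ... | yes refl rewrite e = refl
      ... | no _ = sym (when-0 (test w))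

      mono-dropped : ∀ c u w → test u ≡ false → 0ℚ ≡ when (test w) (mono c u w)
      mono-dropped c u w e with u ≟W w
      ... | yes refl rewrite e = refl
      ... | no _ = sym (when-0 (test w))

    coeff-filter : ∀ p w → coeff (filter (λ t → P? (deg (proj₂ t))) p) w ≡ when (test w) (coeff p w)
    coeff-filter [] w = sym (when-0 (test w))
    coeff-filter ((c , u) ∷ p) w with does (P? (deg u)) in e
    ... | true = begin
          coeff ((c , u) ∷ p') w                           ≡⟨ coeff-cons c u p' w ⟩
          mono c u w Q.+ coeff p' w                        ≡⟨ cong₂ Q._+_ (mono-kept c u w e) (coeff-filter p w) ⟩
          when (test w) (mono c u w) Q.+ when (test w) (coeff p w)  ≡⟨ when-+ (test w) _ _ ⟩
          when (test w) (mono c u w Q.+ coeff p w)        ≡⟨ cong (when (test w)) (sym (coeff-cons c u p w)) ⟩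
          when (test w) (coeff ((c , u) ∷ p) w)           ∎
      where
      open ≡-Reasoning
      p' = filter (λ t → P? (deg (proj₂ t))) p
    ... | false = begin
          coeff (filter (λ t → P? (deg (proj₂ t))) p) w    ≡⟨ coeff-filter p w ⟩
          when (test w) (coeff p w)                        ≡⟨ sym (QP.+-identityˡ _) ⟩
          0ℚ Q.+ when (test w) (coeff p w)                 ≡⟨ cong (Q._+ _) (mono-dropped c u w e) ⟩
          when (test w) (mono c u w) Q.+ when (test w) (coeff p w)  ≡⟨ when-+ (test w) _ _ ⟩
          when (test w) (mono c u w Q.+ coeff p w)        ≡⟨ cong (when (test w)) (sym (coeff-cons c u p w)) ⟩
          when (test w) (coeff ((c , u) ∷ p) w)           ∎
      where open ≡-Reasoning

  coeff-trunc : ∀ N p w → deg w ≤ N → coeff (trunc N p) w ≡ coeff p w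
  coeff-trunc N p w le = trans (coeff-filter (ℕ._≤? N) p w) (when-yes (deg w ℕ.≤? N) le (coeff p w))

  ≈[]-coeff : ∀ N p q → p ≈[ N ] q → ∀ w → deg w ≤ N → coeff p w ≡ coeff q w
  ≈[]-coeff N p q h w le = trans (sym (coeff-trunc N p w le)) (trans (h w) (coeff-trunc N q w le))

  homogeneous-coeff : ∀ k p → Homogeneous k p → ∀ w → deg w ≢ k → coeff p w ≡ 0ℚ
  homogeneous-coeff k p h w ne = trans (h w) (trans (coeff-filter (ℕ._≟ k) p w) (when-no (deg w ℕ.≟ k) ne (coeff p w)))

open Coefficients NP._≟_ suc public
module MRCoefficients = Coefficients _≟MR_ (λ a → suc (proj₁ a))

-- Noncommutative series over the letters of Sym
--
-- Series are
-- arbitrary coefficient functions; the concatenation (Cauchy) product is computed by peeling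
-- off the first letter of the word, so that all its laws are proved by induction on words.

Word : Set
Word = List ℕ

Ser : Set
Ser = Word → ℚ

dg : Word → ℕ
dg = SymP.deg

∂ : ℕ → Ser → Ser
∂ a f u = f (a ∷ u)

conv : Ser → Ser → Ser
conv f g [] = f [] Q.* g []
conv f g (a ∷ w) = f [] Q.* g (a ∷ w) Q.+ conv (∂ a f) g w

δ : Ser
δ [] = 1ℚ
δ (_ ∷ _) = 0ℚ

zS : Ser
zS _ = 0ℚ

infixl 6 _⊹_
infixr 7 _⋆_

_⊹_ : Ser → Ser → Ser
(f ⊹ g) w = f w Q.+ g w

_⋆_ : ℚ → Ser → Ser
(c ⋆ f) w = c Q.* f w

+-interchange : ∀ x y z t → (x Q.+ y) Q.+ (z Q.+ t) ≡ (x Q.+ z) Q.+ (y Q.+ t)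
+-interchange = solve 4 (λ x y z t → (x :+ y) :+ (z :+ t) := (x :+ z) :+ (y :+ t)) refl

*-leftSwap : ∀ x y z → x Q.* (y Q.* z) ≡ y Q.* (x Q.* z)
*-leftSwap = solve 3 (λ x y z → x :* (y :* z) := y :* (x :* z)) refl

conv-cong : ∀ {f f' g g'} → f ≗ f' → g ≗ g' → conv f g ≗ conv f' g'
conv-cong ff gg [] = cong₂ Q._*_ (ff []) (gg [])
conv-cong {f} {f'} ff gg (a ∷ w) =
  cong₂ Q._+_ (cong₂ Q._*_ (ff []) (gg (a ∷ w))) (conv-cong {∂ a f} {∂ a f'} (λ u → ff (a ∷ u)) gg w)

conv-zeroˡ : ∀ g → conv zS g ≗ zS
conv-zeroˡ g [] = QP.*-zeroˡ (g [])
conv-zeroˡ g (a ∷ w) = trans (cong₂ Q._+_ (QP.*-zeroˡ (g (a ∷ w))) (conv-zeroˡ g w)) (QP.+-identityˡ 0ℚ)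

conv-zeroʳ : ∀ f → conv f zS ≗ zS
conv-zeroʳ f [] = QP.*-zeroʳ (f [])
conv-zeroʳ f (a ∷ w) = trans (cong₂ Q._+_ (QP.*-zeroʳ (f [])) (conv-zeroʳ (∂ a f) w)) (QP.+-identityˡ 0ℚ)

conv-identityˡ : ∀ g → conv δ g ≗ g
conv-identityˡ g [] = QP.*-identityˡ (g [])
conv-identityˡ g (a ∷ w) = trans (cong₂ Q._+_ (QP.*-identityˡ (g (a ∷ w))) (conv-zeroˡ g w)) (QP.+-identityʳ _)

conv-identityʳ : ∀ f → conv f δ ≗ f
conv-identityʳ f [] = QP.*-identityʳ (f [])
conv-identityʳ f (a ∷ w) = trans (cong₂ Q._+_ (QP.*-zeroʳ (f [])) (conv-identityʳ (∂ a f) w)) (QP.+-identityˡ _)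

conv-distribʳ : ∀ f g h → conv (f ⊹ g) h ≗ conv f h ⊹ conv g h
conv-distribʳ f g h [] = QP.*-distribʳ-+ (h []) (f []) (g [])
conv-distribʳ f g h (a ∷ w) =
  trans (cong₂ Q._+_ (QP.*-distribʳ-+ (h (a ∷ w)) (f []) (g [])) (conv-distribʳ (∂ a f) (∂ a g) h w))
        (+-interchange (f [] Q.* h (a ∷ w)) (g [] Q.* h (a ∷ w)) (conv (∂ a f) h w) (conv (∂ a g) h w))

conv-distribˡ : ∀ f g h → conv f (g ⊹ h) ≗ conv f g ⊹ conv f h
conv-distribˡ f g h [] = QP.*-distribˡ-+ (f []) (g []) (h [])
conv-distribˡ f g h (a ∷ w) =
  trans (cong₂ Q._+_ (QP.*-distribˡ-+ (f []) (g (a ∷ w)) (h (a ∷ w))) (conv-distribˡ (∂ a f) g h w))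
        (+-interchange (f [] Q.* g (a ∷ w)) (f [] Q.* h (a ∷ w)) (conv (∂ a f) g w) (conv (∂ a f) h w))

conv-scaleˡ : ∀ c f g → conv (c ⋆ f) g ≗ c ⋆ conv f g
conv-scaleˡ c f g [] = QP.*-assoc c (f []) (g [])
conv-scaleˡ c f g (a ∷ w) =
  trans (cong₂ Q._+_ (QP.*-assoc c (f []) (g (a ∷ w))) (conv-scaleˡ c (∂ a f) g w))
        (sym (QP.*-distribˡ-+ c (f [] Q.* g (a ∷ w)) (conv (∂ a f) g w)))

conv-scaleʳ : ∀ c f g → conv f (c ⋆ g) ≗ c ⋆ conv f g
conv-scaleʳ c f g [] = *-leftSwap (f []) c (g [])
conv-scaleʳ c f g (a ∷ w) =
  trans (cong₂ Q._+_ (*-leftSwap (f []) c (g (a ∷ w))) (conv-scaleʳ c (∂ a f) g w))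
        (sym (QP.*-distribˡ-+ c (f [] Q.* g (a ∷ w)) (conv (∂ a f) g w)))

-- Associativity; the induction uses ∂ a (f g) = f(∅)·∂ a g + (∂ a f) g.
conv-assoc : ∀ f g h → conv (conv f g) h ≗ conv f (conv g h)
conv-assoc f g h [] = QP.*-assoc (f []) (g []) (h [])
conv-assoc f g h (a ∷ w) = begin
    (f₀ Q.* g []) Q.* h (a ∷ w) Q.+ conv (∂ a (conv f g)) h w
  ≡⟨ cong (f₀ Q.* g [] Q.* h (a ∷ w) Q.+_) (conv-distribʳ (f₀ ⋆ ∂ a g) (conv (∂ a f) g) h w) ⟩
    (f₀ Q.* g []) Q.* h (a ∷ w) Q.+ (conv (f₀ ⋆ ∂ a g) h w Q.+ conv (conv (∂ a f) g) h w)
  ≡⟨ cong (f₀ Q.* g [] Q.* h (a ∷ w) Q.+_)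
       (cong₂ Q._+_ (conv-scaleˡ f₀ (∂ a g) h w) (conv-assoc (∂ a f) g h w)) ⟩
    (f₀ Q.* g []) Q.* h (a ∷ w) Q.+ (f₀ Q.* conv (∂ a g) h w Q.+ conv (∂ a f) (conv g h) w)
  ≡⟨ regroup f₀ (g []) (h (a ∷ w)) (conv (∂ a g) h w) _ ⟩
    f₀ Q.* (g [] Q.* h (a ∷ w) Q.+ conv (∂ a g) h w) Q.+ conv (∂ a f) (conv g h) w
  ∎
  where
  open ≡-Reasoning
  f₀ = f []
  regroup : ∀ x y z t s → (x Q.* y) Q.* z Q.+ (x Q.* t Q.+ s) ≡ x Q.* (y Q.* z Q.+ t) Q.+ s
  regroup = solve 5 (λ x y z t s → (x :* y) :* z :+ (x :* t :+ s) := x :* (y :* z :+ t) :+ s) refl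

ssum : List Ser → Ser
ssum [] = zS
ssum (f ∷ fs) = f ⊹ ssum fs

sprod : List Ser → Ser
sprod [] = δ
sprod (f ∷ fs) = conv f (sprod fs)

spow : Ser → ℕ → Ser
spow f zero = δ
spow f (suc m) = conv f (spow f m)

sexp : ℕ → Ser → Ser
sexp N f = ssum (map (λ m → invFact m ⋆ spow f m) (upTo (suc N)))

module _ {X : Set} where

  ssum-map-cong : ∀ (F G : X → Ser) L → All (λ x → F x ≗ G x) L → ssum (map F L) ≗ ssum (map G L)
  ssum-map-cong F G [] [] w = refl
  ssum-map-cong F G (x ∷ L) (e ∷ es) w = cong₂ Q._+_ (e w) (ssum-map-cong F G L es w)

  sprod-map-cong : ∀ (F G : X → Ser) L → All (λ x → F x ≗ G x) L → sprod (map F L) ≗ sprod (map G L)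
  sprod-map-cong F G [] [] w = refl
  sprod-map-cong F G (x ∷ L) (e ∷ es) = conv-cong e (sprod-map-cong F G L es)

spow-cong : ∀ {f g} → f ≗ g → ∀ m → spow f m ≗ spow g m
spow-cong e zero w = refl
spow-cong e (suc m) = conv-cong e (spow-cong e m)

sexp-cong : ∀ {f g} N → f ≗ g → sexp N f ≗ sexp N g
sexp-cong {f} {g} N e = ssum-map-cong (λ m → invFact m ⋆ spow f m) (λ m → invFact m ⋆ spow g m) (upTo (suc N))
  (All.universal (λ m w → cong (invFact m Q.*_) (spow-cong e m w)) (upTo (suc N)))

ssum-++ : ∀ xs ys → ssum (xs ++ ys) ≗ ssum xs ⊹ ssum ys
ssum-++ [] ys w = sym (QP.+-identityˡ _)
ssum-++ (x ∷ xs) ys w = trans (cong (x w Q.+_) (ssum-++ xs ys w)) (sym (QP.+-assoc (x w) (ssum xs w) (ssum ys w)))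

conv-ssum : ∀ x fs → conv x (ssum fs) ≗ ssum (map (conv x) fs)
conv-ssum x [] w = conv-zeroʳ x w
conv-ssum x (f ∷ fs) w = trans (conv-distribˡ x f (ssum fs) w) (cong (conv x f w Q.+_) (conv-ssum x fs w))

sprod-++ : ∀ xs ys → sprod (xs ++ ys) ≗ conv (sprod xs) (sprod ys)
sprod-++ [] ys w = sym (conv-identityˡ (sprod ys) w)
sprod-++ (x ∷ xs) ys w = trans (conv-cong (λ _ → refl) (sprod-++ xs ys) w) (sym (conv-assoc x (sprod xs) (sprod ys) w))

sprod-∷ʳ : ∀ xs y → sprod (xs L.∷ʳ y) ≗ conv (sprod xs) y
sprod-∷ʳ xs y w = trans (sprod-++ xs (y ∷ []) w) (conv-cong (λ _ → refl) (conv-identityʳ y) w)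

sprod-reverse-∷ : ∀ x xs → sprod (reverse (x ∷ xs)) ≗ conv (sprod (reverse xs)) x
sprod-reverse-∷ x xs w = trans (cong (λ q → sprod q w) (LP.unfold-reverse x xs)) (sprod-∷ʳ (reverse xs) x w)

sprod-reverse-map-cong : ∀ {X : Set} (F G : X → Ser) L → All (λ x → F x ≗ G x) L →
  sprod (reverse (map F L)) ≗ sprod (reverse (map G L))
sprod-reverse-map-cong F G [] [] w = refl
sprod-reverse-map-cong F G (x ∷ L) (e ∷ es) w = begin
    sprod (reverse (F x ∷ map F L)) w          ≡⟨ sprod-reverse-∷ (F x) (map F L) w ⟩
    conv (sprod (reverse (map F L))) (F x) w   ≡⟨ conv-cong (sprod-reverse-map-cong F G L es) e w ⟩
    conv (sprod (reverse (map G L))) (G x) w   ≡⟨ sym (sprod-reverse-∷ (G x) (map G L) w) ⟩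
    sprod (reverse (G x ∷ map G L)) w          ∎
  where open ≡-Reasoning

cf : SymPol → Ser
cf = SymP.coeff

cf-one : cf SymP.oneP ≗ δ
cf-one [] = refl
cf-one (_ ∷ _) = refl

cf-letter : ∀ j → cf (SymP.letter j) ≗ mono 1ℚ (j ∷ [])
cf-letter j w = trans (coeff-cons 1ℚ (j ∷ []) [] w) (QP.+-identityʳ _)

mono-[] : ∀ c → mono c [] ≗ c ⋆ δ
mono-[] c [] = sym (QP.*-identityʳ c)
mono-[] c (_ ∷ _) = sym (QP.*-zeroʳ c)

prefix : ℕ → ℚ × Word → ℚ × Word
prefix a t = (proj₁ t , a ∷ proj₂ t)

cf-prefix-[] : ∀ a p → cf (map (prefix a) p) [] ≡ 0ℚ
cf-prefix-[] a [] = refl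
cf-prefix-[] a (t ∷ p) = cf-prefix-[] a p

cf-prefix-∷ : ∀ a b p w → cf (map (prefix a) p) (b ∷ w) ≡ when (does (a ℕ.≟ b)) (cf p w)
cf-prefix-∷ a b [] w with does (a ℕ.≟ b)
... | true = refl
... | false = refl
cf-prefix-∷ a b ((c , u) ∷ p) w with does (a ℕ.≟ b) | cf-prefix-∷ a b p w
... | true | ih with does (u SymP.≟W w)
...   | true = cong (c Q.+_) ih
...   | false = ih
cf-prefix-∷ a b ((c , u) ∷ p) w | false | ih = ih

leftMul : ℚ → Word → SymPol → SymPol
leftMul c u q = map (λ t → (c Q.* proj₁ t , u ++ proj₂ t)) q

cf-leftMul : ∀ c u q → cf (leftMul c u q) ≗ conv (mono c u) (cf q)
cf-leftMul c [] q w = begin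
    cf (c SymP.· q) w                ≡⟨ coeff-· c q w ⟩
    c Q.* cf q w                     ≡⟨ cong (c Q.*_) (sym (conv-identityˡ (cf q) w)) ⟩
    c Q.* conv δ (cf q) w            ≡⟨ sym (conv-scaleˡ c δ (cf q) w) ⟩
    conv (c ⋆ δ) (cf q) w            ≡⟨ sym (conv-cong (mono-[] c) (λ _ → refl) w) ⟩
    conv (mono c []) (cf q) w        ∎
  where open ≡-Reasoning
cf-leftMul c (a ∷ u) q [] =
  trans (trans (cong (λ p → cf p []) (LP.map-∘ q)) (cf-prefix-[] a (leftMul c u q))) (sym (QP.*-zeroˡ (cf q [])))
cf-leftMul c (a ∷ u) q (b ∷ w) = begin
    cf (leftMul c (a ∷ u) q) (b ∷ w)                    ≡⟨ cong (λ p → cf p (b ∷ w)) (LP.map-∘ q) ⟩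
    cf (map (prefix a) (leftMul c u q)) (b ∷ w)         ≡⟨ cf-prefix-∷ a b (leftMul c u q) w ⟩
    when (does (a ℕ.≟ b)) (cf (leftMul c u q) w)        ≡⟨ tail (a ℕ.≟ b) ⟩
    conv (∂ b (mono c (a ∷ u))) (cf q) w                ≡⟨ sym (QP.+-identityˡ _) ⟩
    0ℚ Q.+ conv (∂ b (mono c (a ∷ u))) (cf q) w         ≡⟨ cong (Q._+ conv (∂ b (mono c (a ∷ u))) (cf q) w) (sym (QP.*-zeroˡ (cf q (b ∷ w)))) ⟩
    conv (mono c (a ∷ u)) (cf q) (b ∷ w)                ∎
  where
  open ≡-Reasoning
  tail : (d : Dec (a ≡ b)) → when (does d) (cf (leftMul c u q) w)
                           ≡ conv (λ v → when (does d ∧ does (u SymP.≟W v)) c) (cf q) w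
  tail (yes _) = cf-leftMul c u q w
  tail (no _) = sym (conv-zeroˡ (cf q) w)

cf-⊗ : ∀ p q → cf (p SymP.⊗ q) ≗ conv (cf p) (cf q)
cf-⊗ [] q w = sym (conv-zeroˡ (cf q) w)
cf-⊗ ((c , u) ∷ p) q w = begin
    cf (leftMul c u q ++ (p SymP.⊗ q)) w                  ≡⟨ coeff-++ (leftMul c u q) (p SymP.⊗ q) w ⟩
    cf (leftMul c u q) w Q.+ cf (p SymP.⊗ q) w            ≡⟨ cong₂ Q._+_ (cf-leftMul c u q w) (cf-⊗ p q w) ⟩
    conv (mono c u) (cf q) w Q.+ conv (cf p) (cf q) w     ≡⟨ sym (conv-distribʳ (mono c u) (cf p) (cf q) w) ⟩
    conv (mono c u ⊹ cf p) (cf q) w                       ≡⟨ sym (conv-cong (coeff-cons c u p) (λ _ → refl) w) ⟩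
    conv (cf ((c , u) ∷ p)) (cf q) w                      ∎
  where open ≡-Reasoning

module _ {X : Set} (h : X → SymPol) (G : X → Ser) (e : ∀ x → cf (h x) ≗ G x) where

  cf-sumP-map : ∀ L → cf (SymP.sumP (map h L)) ≗ ssum (map G L)
  cf-sumP-map [] w = refl
  cf-sumP-map (x ∷ L) w = trans (coeff-++ (h x) (SymP.sumP (map h L)) w) (cong₂ Q._+_ (e x w) (cf-sumP-map L w))

  cf-prodP-map : ∀ L → cf (SymP.prodP (map h L)) ≗ sprod (map G L)
  cf-prodP-map [] w = cf-one w
  cf-prodP-map (x ∷ L) w = trans (cf-⊗ (h x) (SymP.prodP (map h L)) w) (conv-cong (e x) (cf-prodP-map L) w)

  cf-prodP-reverse-map : ∀ L → cf (SymP.prodP (reverse (map h L))) ≗ sprod (reverse (map G L))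
  cf-prodP-reverse-map L w = begin
      cf (SymP.prodP (reverse (map h L))) w   ≡⟨ cong (λ q → cf (SymP.prodP q) w) (sym (LP.reverse-map h L)) ⟩
      cf (SymP.prodP (map h (reverse L))) w   ≡⟨ cf-prodP-map (reverse L) w ⟩
      sprod (map G (reverse L)) w             ≡⟨ cong (λ q → sprod q w) (LP.reverse-map G L) ⟩
      sprod (reverse (map G L)) w             ∎
    where open ≡-Reasoning

cf-powP : ∀ p m → cf (SymP.powP p m) ≗ spow (cf p) m
cf-powP p zero = cf-one
cf-powP p (suc m) w = trans (cf-⊗ p (SymP.powP p m) w) (conv-cong (λ _ → refl) (cf-powP p m) w)

cf-expT : ∀ N p → cf (SymP.expT N p) ≗ sexp N (cf p)
cf-expT N p = cf-sumP-map (λ m → invFact m SymP.· SymP.powP p m) (λ m → invFact m ⋆ spow (cf p) m)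
  (λ m w → trans (coeff-· (invFact m) (SymP.powP p m) w) (cong (invFact m Q.*_) (cf-powP p m w))) (upTo (suc N))

-- Identities between truncated power series are only meaningful in degrees ≤ N, so they are
-- stated as Agree N f g.  Series whose constant term is 1 are cancellable on either side.

Agree : ℕ → Ser → Ser → Set
Agree d f g = ∀ w → dg w ≤ d → f w ≡ g w

Agree-refl : ∀ {d f} → Agree d f f
Agree-refl w _ = refl

Agree-sym : ∀ {d f g} → Agree d f g → Agree d g f
Agree-sym h w le = sym (h w le)

Agree-trans : ∀ {d f g h} → Agree d f g → Agree d g h → Agree d f h
Agree-trans h1 h2 w le = trans (h1 w le) (h2 w le)

≗⇒Agree : ∀ {d f g} → f ≗ g → Agree d f g
≗⇒Agree h w _ = h w

Agree-mono : ∀ {d e f g} → e ≤ d → Agree d f g → Agree e f g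
Agree-mono ed h w le = h w (NP.≤-trans le ed)

≈[]⇒Agree : ∀ N p q → p SymP.≈[ N ] q → Agree N (cf p) (cf q)
≈[]⇒Agree = ≈[]-coeff

+≤⇒≤∸ : ∀ s n d → s ℕ.+ n ≤ d → n ≤ d ∸ s
+≤⇒≤∸ s n d h = NP.m+n≤o⇒m≤o∸n n (subst (_≤ d) (NP.+-comm s n) h)

≤∸⇒+≤ : ∀ s n d → s ≤ d → n ≤ d ∸ s → s ℕ.+ n ≤ d
≤∸⇒+≤ s n d s≤d h = subst (_≤ d) (NP.+-comm n s) (NP.m≤o∸n⇒m+n≤o n s≤d h)

<∸⇒+< : ∀ s n p → n < p ∸ s → s ℕ.+ n < p
<∸⇒+< zero n p h = h
<∸⇒+< (suc s) n zero ()
<∸⇒+< (suc s) n (suc p) h = s≤s (<∸⇒+< s n p h)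

+<+⇒<∸+ : ∀ s n p q → s ℕ.+ n < p ℕ.+ q → n < (p ∸ s) ℕ.+ q
+<+⇒<∸+ zero n p q h = h
+<+⇒<∸+ (suc s) n zero q h =
  NP.≤-trans (NP.m≤n+m (suc n) s) (NP.≤-trans (NP.≤-reflexive (NP.+-suc s n)) (NP.≤-pred (NP.≤-trans h (NP.n≤1+n _))))
+<+⇒<∸+ (suc s) n (suc p) q (s≤s h) = +<+⇒<∸+ s n p q h

conv-agree : ∀ d {f f' g g'} → Agree d f f' → Agree d g g' → Agree d (conv f g) (conv f' g')
conv-agree d hf hg [] le = cong₂ Q._*_ (hf [] z≤n) (hg [] z≤n)
conv-agree d {f} {f'} hf hg (a ∷ w) le =
  cong₂ Q._+_ (cong₂ Q._*_ (hf [] z≤n) (hg (a ∷ w) le))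
    (conv-agree (d ∸ suc a) {∂ a f} {∂ a f'}
      (λ u h → hf (a ∷ u) (≤∸⇒+≤ (suc a) (dg u) d (NP.≤-trans (NP.m≤m+n (suc a) (dg w)) le) h))
      (λ u h → hg u (NP.≤-trans h (NP.m∸n≤m d (suc a))))
      w (+≤⇒≤∸ (suc a) (dg w) d le))

Van : ℕ → Ser → Set
Van d f = ∀ w → dg w < d → f w ≡ 0ℚ

Van-mono : ∀ {d e f} → e ≤ d → Van d f → Van e f
Van-mono ed h w lt = h w (NP.≤-trans lt ed)

conv-van : ∀ p q {f g} → Van p f → Van q g → Van (p ℕ.+ q) (conv f g)
conv-van zero q {f} hf hg [] h = trans (cong (f [] Q.*_) (hg [] h)) (QP.*-zeroʳ (f []))
conv-van (suc p) q {f} {g} hf hg [] h = trans (cong (Q._* g []) (hf [] (s≤s z≤n))) (QP.*-zeroˡ (g []))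
conv-van p q {f} {g} hf hg (a ∷ w) h =
  trans (cong₂ Q._+_ (head p hf h) (conv-van (p ∸ suc a) q {∂ a f} (λ u hu → hf (a ∷ u) (<∸⇒+< (suc a) (dg u) p hu)) hg w
                                   (+<+⇒<∸+ (suc a) (dg w) p q h)))
        (QP.+-identityˡ 0ℚ)
  where
  head : ∀ p → Van p f → dg (a ∷ w) < p ℕ.+ q → f [] Q.* g (a ∷ w) ≡ 0ℚ
  head zero _ h = trans (cong (f [] Q.*_) (hg (a ∷ w) h)) (QP.*-zeroʳ (f []))
  head (suc p) hf _ = trans (cong (Q._* g (a ∷ w)) (hf [] (s≤s z≤n))) (QP.*-zeroˡ (g (a ∷ w)))

dg≤0⇒[] : ∀ w → dg w ≤ 0 → w ≡ []
dg≤0⇒[] [] _ = refl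
dg≤0⇒[] (a ∷ w) ()

unit-head : ∀ {f : Ser} → f [] ≡ 1ℚ → ∀ x → f [] Q.* x ≡ x
unit-head f1 x = trans (cong (Q._* x) f1) (QP.*-identityˡ x)

cancelˡ : ∀ d {f g h} → f [] ≡ 1ℚ → Agree d (conv f g) (conv f h) → Agree d g h
cancelˡ d {f} {g} {h} f1 H = go d NP.≤-refl
  where
  base : g [] ≡ h []
  base = trans (sym (unit-head {f} f1 (g []))) (trans (H [] z≤n) (unit-head {f} f1 (h [])))
  go : ∀ e → e ≤ d → Agree e g h
  go zero _ w le rewrite dg≤0⇒[] w le = base
  go (suc e) ed [] _ = base
  go (suc e) ed (a ∷ w) le =
    trans (sym (unit-head {f} f1 (g (a ∷ w))))
      (trans (∙-cancelʳ (conv (∂ a f) g w) (f [] Q.* g (a ∷ w)) (f [] Q.* h (a ∷ w))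
                (trans (H (a ∷ w) (NP.≤-trans le ed)) (cong (f [] Q.* h (a ∷ w) Q.+_) (sym tail))))
             (unit-head {f} f1 (h (a ∷ w))))
    where
    tail : conv (∂ a f) g w ≡ conv (∂ a f) h w
    tail = conv-agree (dg w) Agree-refl
             (Agree-mono (NP.≤-trans (NP.m≤n+m (dg w) a) (NP.≤-pred le)) (go e (NP.≤-trans (NP.n≤1+n e) ed))) w NP.≤-refl

cancelʳ : ∀ d {f g h} → f [] ≡ 1ℚ → Agree d (conv g f) (conv h f) → Agree d g h
cancelʳ d {f} {g} {h} f1 H [] le =
  trans (sym (QP.*-identityʳ (g []))) (trans (cong (g [] Q.*_) (sym f1)) (trans (H [] z≤n)
    (trans (cong (h [] Q.*_) f1) (QP.*-identityʳ (h [])))))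
cancelʳ d {f} {g} {h} f1 H (a ∷ w) le = cancelʳ (d ∸ suc a) {f} {∂ a g} {∂ a h} f1 H' w (+≤⇒≤∸ (suc a) (dg w) d le)
  where
  g₀≡h₀ : g [] ≡ h []
  g₀≡h₀ = cancelʳ d f1 H [] z≤n
  -- the coefficient of a·u in g f is g(∅) f(a u) + ((∂ a g) f)(u)
  H' : Agree (d ∸ suc a) (conv (∂ a g) f) (conv (∂ a h) f)
  H' u hu = ∙-cancelʳ (g [] Q.* f (a ∷ u)) (conv (∂ a g) f u) (conv (∂ a h) f u) (begin
      conv (∂ a g) f u Q.+ g [] Q.* f (a ∷ u)   ≡⟨ QP.+-comm (conv (∂ a g) f u) (g [] Q.* f (a ∷ u)) ⟩
      conv g f (a ∷ u)                          ≡⟨ H (a ∷ u) (≤∸⇒+≤ (suc a) (dg u) d (NP.≤-trans (NP.m≤m+n (suc a) (dg w)) le) hu) ⟩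
      conv h f (a ∷ u)                          ≡⟨ cong (λ x → x Q.* f (a ∷ u) Q.+ conv (∂ a h) f u) (sym g₀≡h₀) ⟩
      g [] Q.* f (a ∷ u) Q.+ conv (∂ a h) f u   ≡⟨ QP.+-comm (g [] Q.* f (a ∷ u)) (conv (∂ a h) f u) ⟩
      conv (∂ a h) f u Q.+ g [] Q.* f (a ∷ u)   ∎)
    where open ≡-Reasoning

cancel-outer : ∀ d {A B X Y} → A [] ≡ 1ℚ → B [] ≡ 1ℚ → Agree d (conv A (conv X B)) (conv A (conv Y B)) → Agree d X Y
cancel-outer d A1 B1 H = cancelʳ d B1 (cancelˡ d A1 H)

ssum-vanishing : ∀ (F : ℕ → Ser) w (f : ℕ → ℕ) → (∀ j → F (f j) w ≡ 0ℚ) → ∀ K →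
  ssum (map F (L.applyUpTo f K)) w ≡ 0ℚ
ssum-vanishing F w f h zero = refl
ssum-vanishing F w f h (suc K) =
  trans (cong₂ Q._+_ (h 0) (ssum-vanishing F w (f ∘ suc) (λ j → h (suc j)) K)) (QP.+-identityˡ 0ℚ)

sexp-tail-vanishing : ∀ N x w → (∀ j → spow x (suc j) w ≡ 0ℚ) → sexp N x w ≡ δ w
sexp-tail-vanishing N x w h = trans (cong₂ Q._+_ (QP.*-identityˡ (δ w))
    (ssum-vanishing (λ m → invFact m ⋆ spow x m) w suc (λ j → trans (cong (invFact (suc j) Q.*_) (h j)) (QP.*-zeroʳ (invFact (suc j)))) N))
  (QP.+-identityʳ (δ w))

spow-van : ∀ n x → Van n x → ∀ m → Van n (spow x (suc m))
spow-van n x h m w lt = conv-van n 0 h (λ _ ()) w (subst (dg w <_) (sym (NP.+-identityʳ n)) lt)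

sexp-low : ∀ N n x → Van n x → ∀ w → dg w < n → sexp N x w ≡ δ w
sexp-low N n x h w lt = sexp-tail-vanishing N x w (λ j → spow-van n x h j w lt)

sexp-constant : ∀ N x → Van 1 x → sexp N x [] ≡ 1ℚ
sexp-constant N x h = sexp-low N 1 x h [] (s≤s z≤n)

sexp-at-order : ∀ N n x → Van n x → ∀ w → 0 < n → dg w ≡ n → sexp (suc N) x w ≡ x w
sexp-at-order N n x h [] pos e = ⊥-elim (NP.<-irrefl e pos)
sexp-at-order N n x h (a ∷ u) pos e = begin
    1ℚ Q.* 0ℚ Q.+ (invFact 1 Q.* conv x δ (a ∷ u) Q.+ higher)
  ≡⟨ cong₂ Q._+_ (QP.*-zeroʳ 1ℚ) (cong₂ Q._+_ (trans (QP.*-identityˡ _) (conv-identityʳ x (a ∷ u)))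
       (ssum-vanishing (λ m → invFact m ⋆ spow x m) (a ∷ u) (suc ∘ suc) higher-powers N)) ⟩
    0ℚ Q.+ (x (a ∷ u) Q.+ 0ℚ)
  ≡⟨ trans (QP.+-identityˡ _) (QP.+-identityʳ (x (a ∷ u))) ⟩
    x (a ∷ u)
  ∎
  where
  open ≡-Reasoning
  higher = ssum (map (λ m → invFact m ⋆ spow x m) (L.applyUpTo (suc ∘ suc) N)) (a ∷ u)
  -- x^{j+2} has order ≥ 2n > n
  higher-powers : ∀ j → invFact (suc (suc j)) Q.* spow x (suc (suc j)) (a ∷ u) ≡ 0ℚ
  higher-powers j = trans (cong (invFact (suc (suc j)) Q.*_)
      (conv-van n n h (spow-van n x h j) (a ∷ u) (subst (_< n ℕ.+ n) (sym e) (NP.m<m+n n pos))))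
    (QP.*-zeroʳ (invFact (suc (suc j))))

conv-near-one : ∀ n f g → Agree n f δ → Agree n g δ → ∀ w → dg w ≡ suc n → conv f g w ≡ f w Q.+ g w
conv-near-one n f g hf hg [] ()
conv-near-one n f g hf hg (a ∷ u) e = begin
    f [] Q.* g (a ∷ u) Q.+ conv (∂ a f) g u
  ≡⟨ cong₂ Q._+_ (trans (cong (Q._* g (a ∷ u)) (hf [] z≤n)) (QP.*-identityˡ (g (a ∷ u))))
       (trans (conv-agree (dg u) Agree-refl (Agree-mono du hg) u NP.≤-refl) (conv-identityʳ (∂ a f) u)) ⟩
    g (a ∷ u) Q.+ f (a ∷ u)
  ≡⟨ QP.+-comm (g (a ∷ u)) (f (a ∷ u)) ⟩
    f (a ∷ u) Q.+ g (a ∷ u)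
  ∎
  where
  open ≡-Reasoning
  du : dg u ≤ n
  du = NP.≤-pred (NP.≤-trans (s≤s (NP.m≤n+m (dg u) a)) (NP.≤-reflexive e))

sexp-square-at-order : ∀ n x → Van (suc n) x → ∀ w → dg w ≡ suc n →
  conv (sexp (suc n) x) (sexp (suc n) x) w ≡ x w Q.+ x w
sexp-square-at-order n x h w e =
  trans (conv-near-one n E E near near w e) (cong₂ Q._+_ at at)
  where
  E = sexp (suc n) x
  near : Agree n E δ
  near w le = sexp-low (suc n) (suc n) x h w (s≤s le)
  at : E w ≡ x w
  at = sexp-at-order n (suc n) x h w (s≤s z≤n) e

double-injective : ∀ x y → x Q.+ x ≡ y Q.+ y → x ≡ y
double-injective x y e = begin
    x                 ≡⟨ solve 1 (λ x → x := (x :+ x) :* con Q.½) refl x ⟩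
    (x Q.+ x) Q.* Q.½ ≡⟨ cong (Q._* Q.½) e ⟩
    (y Q.+ y) Q.* Q.½ ≡⟨ solve 1 (λ x → (x :+ x) :* con Q.½ := x) refl y ⟩
    y                 ∎
  where open ≡-Reasoning

-- Series homogeneous of degree n+1 are determined by the square of their exponential
-- up to degree n+1, whose degree-(n+1) part is twice the series.
sexp-square-injective : ∀ n x y → (∀ w → dg w ≢ suc n → x w ≡ 0ℚ) → (∀ w → dg w ≢ suc n → y w ≡ 0ℚ) →
  Agree (suc n) (conv (sexp (suc n) x) (sexp (suc n) x)) (conv (sexp (suc n) y) (sexp (suc n) y)) → x ≗ y
sexp-square-injective n x y hx hy H w with dg w ℕ.≟ suc n
... | no ne = trans (hx w ne) (sym (hy w ne))
... | yes e = double-injective (x w) (y w) (begin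
      x w Q.+ x w                                  ≡⟨ sym (sexp-square-at-order n x (order hx) w e) ⟩
      conv (sexp (suc n) x) (sexp (suc n) x) w     ≡⟨ H w (NP.≤-reflexive e) ⟩
      conv (sexp (suc n) y) (sexp (suc n) y) w     ≡⟨ sexp-square-at-order n y (order hy) w e ⟩
      y w Q.+ y w                                  ∎)
  where
  open ≡-Reasoning
  order : ∀ {f} → (∀ w → dg w ≢ suc n → f w ≡ 0ℚ) → Van (suc n) f
  order h w lt = h w (λ e → NP.<-irrefl e lt)

sprod-constant : ∀ fs → All (λ f → f [] ≡ 1ℚ) fs → sprod fs [] ≡ 1ℚ
sprod-constant [] [] = refl
sprod-constant (f ∷ fs) (h ∷ hs) = trans (cong₂ Q._*_ h (sprod-constant fs hs)) (QP.*-identityˡ 1ℚ)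

sprod-reverse-constant : ∀ fs → All (λ f → f [] ≡ 1ℚ) fs → sprod (reverse fs) [] ≡ 1ℚ
sprod-reverse-constant [] [] = refl
sprod-reverse-constant (f ∷ fs) (h ∷ hs) =
  trans (sprod-reverse-∷ f fs []) (trans (cong₂ Q._*_ (sprod-reverse-constant fs hs) h) (QP.*-identityˡ 1ℚ))

-- Uniqueness of symmetric exponential factorisations

expsUpS : (ℕ → Ser) → ℕ → Ser
expsUpS u N = sprod (map (λ k → sexp N (u k)) (oneTo N))

expsDownS : (ℕ → Ser) → ℕ → Ser
expsDownS u N = sprod (reverse (map (λ k → sexp N (u k)) (oneTo N)))

HomogeneousFamily : (ℕ → Ser) → Set
HomogeneousFamily u = ∀ k w → dg w ≢ suc k → u (suc k) w ≡ 0ℚ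

homogeneous-van : ∀ u → HomogeneousFamily u → ∀ k → Van (suc k) (u (suc k))
homogeneous-van u h k w lt = h k w (λ e → NP.<-irrefl e lt)

homogeneous-sexp-constant : ∀ u → HomogeneousFamily u → ∀ N k → sexp N (u (suc k)) [] ≡ 1ℚ
homogeneous-sexp-constant u h N k = sexp-constant N (u (suc k)) (Van-mono (s≤s z≤n) (homogeneous-van u h k))

oneTo-map : ∀ {X : Set} (F : ℕ → X) n → map F (oneTo n) ≡ map (F ∘ suc) (upTo n)
oneTo-map F n = sym (LP.map-∘ (upTo n))

oneTo-suc : ∀ {X : Set} (F : ℕ → X) n → map F (oneTo (suc n)) ≡ map F (oneTo n) L.∷ʳ F (suc n)
oneTo-suc F n = begin
    map F (map suc (upTo (suc n)))             ≡⟨ cong (map F ∘ map suc) (sym (LP.upTo-∷ʳ n)) ⟩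
    map F (map suc (upTo n L.∷ʳ n))            ≡⟨ cong (map F) (LP.map-++ suc (upTo n) (n ∷ [])) ⟩
    map F (map suc (upTo n) ++ suc n ∷ [])     ≡⟨ LP.map-++ F (map suc (upTo n)) (suc n ∷ []) ⟩
    map F (oneTo n) L.∷ʳ F (suc n)             ∎
  where open ≡-Reasoning

factorisation-split : ∀ x n → let N = suc n; F = λ j → sexp N (x (suc j)) in
  conv (expsUpS x N) (expsDownS x N)
    ≗ conv (sprod (map F (upTo n))) (conv (conv (sexp N (x N)) (sexp N (x N))) (sprod (reverse (map F (upTo n)))))
factorisation-split x n w = begin
    conv (sprod (map G (oneTo N))) (sprod (reverse (map G (oneTo N)))) w
  ≡⟨ cong₂ (λ p q → conv (sprod p) (sprod (reverse q)) w) (oneTo-suc G n) (oneTo-suc G n) ⟩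
    conv (sprod (map G (oneTo n) L.∷ʳ G N)) (sprod (reverse (map G (oneTo n) L.∷ʳ G N))) w
  ≡⟨ cong (λ q → conv (sprod (map G (oneTo n) L.∷ʳ G N)) (sprod q) w) (LP.reverse-++ (map G (oneTo n)) (G N ∷ [])) ⟩
    conv (sprod (map G (oneTo n) L.∷ʳ G N)) (conv (G N) B) w
  ≡⟨ conv-cong (sprod-∷ʳ (map G (oneTo n)) (G N)) (λ _ → refl) w ⟩
    conv (conv A (G N)) (conv (G N) B) w
  ≡⟨ conv-assoc A (G N) (conv (G N) B) w ⟩
    conv A (conv (G N) (conv (G N) B)) w
  ≡⟨ conv-cong (λ _ → refl) (λ w' → sym (conv-assoc (G N) (G N) B w')) w ⟩
    conv A (conv (conv (G N) (G N)) B) w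
  ≡⟨ cong₂ (λ p q → conv (sprod p) (conv (conv (G N) (G N)) (sprod (reverse q))) w) (oneTo-map G n) (oneTo-map G n) ⟩
    conv (sprod (map (G ∘ suc) (upTo n))) (conv (conv (G N) (G N)) (sprod (reverse (map (G ∘ suc) (upTo n))))) w
  ∎
  where
  open ≡-Reasoning
  N = suc n
  G : ℕ → Ser
  G k = sexp N (x k)
  A = sprod (map G (oneTo n))
  B = sprod (reverse (map G (oneTo n)))

-- By strong induction: once u_j = v_j for j ≤ n, cancelling the common outer factors leaves
-- (e^{u_N})² = (e^{v_N})² up to degree N, whose degree-N part is 2u_N = 2v_N.
factorisation-unique : ∀ u v → HomogeneousFamily u → HomogeneousFamily v →
  (∀ N → Agree N (conv (expsUpS u N) (expsDownS u N)) (conv (expsUpS v N) (expsDownS v N))) →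
  ∀ n → u (suc n) ≗ v (suc n)
factorisation-unique u v hu hv H = <-rec (λ n → u (suc n) ≗ v (suc n)) step
  where
  step : ∀ n → (∀ {j} → j < n → u (suc j) ≗ v (suc j)) → u (suc n) ≗ v (suc n)
  step n IH = sexp-square-injective n (u N) (v N) (hu n) (hv n) squares
    where
    N = suc n
    Fu Fv : ℕ → Ser
    Fu j = sexp N (u (suc j))
    Fv j = sexp N (v (suc j))
    Au = sprod (map Fu (upTo n))
    Bu = sprod (reverse (map Fu (upTo n)))
    Eu = sexp N (u N)
    Ev = sexp N (v N)
    lower : All (λ j → Fv j ≗ Fu j) (upTo n)
    lower = AllP.applyUpTo⁺₁ id n (λ lt w → sym (sexp-cong N (IH lt) w))
    same-outer : Agree N (conv Au (conv (conv Eu Eu) Bu)) (conv Au (conv (conv Ev Ev) Bu))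
    same-outer = Agree-trans (≗⇒Agree (λ w → sym (factorisation-split u n w))) (Agree-trans (H N)
      (≗⇒Agree (λ w → trans (factorisation-split v n w)
        (conv-cong (sprod-map-cong Fv Fu (upTo n) lower)
                   (conv-cong (λ _ → refl) (sprod-reverse-map-cong Fv Fu (upTo n) lower)) w))))
    constants : All (λ f → f [] ≡ 1ℚ) (map Fu (upTo n))
    constants = AllP.map⁺ (AllP.applyUpTo⁺₂ id n (homogeneous-sexp-constant u hu N))
    squares : Agree N (conv Eu Eu) (conv Ev Ev)
    squares = cancel-outer N (sprod-constant _ constants) (sprod-reverse-constant _ constants) same-outer

-- The sign involution θ
--
-- θ multiplies the coefficient of each word of degree d by (−1)ᵈ; it is the algebra
-- automorphism S_n ↦ (−1)ⁿ S_n, sending σ₁ to σ(−1).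

sgn-suc-suc : ∀ k → sgn (suc (suc k)) ≡ sgn k
sgn-suc-suc k = cong (λ r → if does (r ℕ.≟ 0) then 1ℚ else Q.- 1ℚ)
  (trans (cong (_% 2) (NP.+-comm 2 k)) (DM.[m+n]%n≡m%n k 2))

sgn-suc : ∀ k → sgn (suc k) ≡ Q.- sgn k
sgn-suc zero = refl
sgn-suc (suc k) = begin
    sgn (suc (suc k))    ≡⟨ sgn-suc-suc k ⟩
    sgn k                ≡⟨ sym (⁻¹-involutive (sgn k)) ⟩
    Q.- (Q.- sgn k)      ≡⟨ cong Q.-_ (sym (sgn-suc k)) ⟩
    Q.- sgn (suc k)      ∎
  where open ≡-Reasoning

sgn-+ : ∀ m n → sgn (m ℕ.+ n) ≡ sgn m Q.* sgn n
sgn-+ zero n = sym (QP.*-identityˡ (sgn n))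
sgn-+ (suc m) n = begin
    sgn (suc (m ℕ.+ n))      ≡⟨ sgn-suc (m ℕ.+ n) ⟩
    Q.- sgn (m ℕ.+ n)        ≡⟨ cong Q.-_ (sgn-+ m n) ⟩
    Q.- (sgn m Q.* sgn n)    ≡⟨ QP.neg-distribˡ-* (sgn m) (sgn n) ⟩
    Q.- sgn m Q.* sgn n      ≡⟨ cong (Q._* sgn n) (sym (sgn-suc m)) ⟩
    sgn (suc m) Q.* sgn n    ∎
  where open ≡-Reasoning

sgn-even : ∀ k → isEven k ≡ true → sgn k ≡ 1ℚ
sgn-even k e = cong (λ b → if b then 1ℚ else Q.- 1ℚ) e

sgn-odd : ∀ k → isEven k ≡ false → sgn k ≡ Q.- 1ℚ
sgn-odd k e = cong (λ b → if b then 1ℚ else Q.- 1ℚ) e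

θ : Ser → Ser
θ f w = sgn (dg w) Q.* f w

θ-agree : ∀ {d f g} → Agree d f g → Agree d (θ f) (θ g)
θ-agree e w le = cong (sgn (dg w) Q.*_) (e w le)

θ-δ : θ δ ≗ δ
θ-δ [] = QP.*-identityˡ 1ℚ
θ-δ (a ∷ w) = QP.*-zeroʳ (sgn (dg (a ∷ w)))

θ-⋆ : ∀ c f → θ (c ⋆ f) ≗ c ⋆ θ f
θ-⋆ c f w = *-leftSwap (sgn (dg w)) c (f w)

θ-∂ : ∀ a f → ∂ a (θ f) ≗ sgn (suc a) ⋆ θ (∂ a f)
θ-∂ a f u = trans (cong (Q._* f (a ∷ u)) (sgn-+ (suc a) (dg u))) (QP.*-assoc (sgn (suc a)) (sgn (dg u)) (f (a ∷ u)))

-- θ is multiplicative, because degrees add under concatenation.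
θ-conv : ∀ f g → θ (conv f g) ≗ conv (θ f) (θ g)
θ-conv f g [] = solve 2 (λ x y → con 1ℚ :* (x :* y) := (con 1ℚ :* x) :* (con 1ℚ :* y)) refl (f []) (g [])
θ-conv f g (a ∷ w) = begin
    s Q.* (f [] Q.* g (a ∷ w) Q.+ conv (∂ a f) g w)
  ≡⟨ solve 4 (λ s x y z → s :* (x :* y :+ z) := (con 1ℚ :* x) :* (s :* y) :+ s :* z) refl s (f []) (g (a ∷ w)) (conv (∂ a f) g w) ⟩
    (1ℚ Q.* f []) Q.* (s Q.* g (a ∷ w)) Q.+ s Q.* conv (∂ a f) g w
  ≡⟨ cong ((1ℚ Q.* f []) Q.* (s Q.* g (a ∷ w)) Q.+_) tail ⟩
    (1ℚ Q.* f []) Q.* (s Q.* g (a ∷ w)) Q.+ conv (∂ a (θ f)) (θ g) w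
  ∎
  where
  open ≡-Reasoning
  s = sgn (dg (a ∷ w))
  tail : s Q.* conv (∂ a f) g w ≡ conv (∂ a (θ f)) (θ g) w
  tail = begin
      s Q.* conv (∂ a f) g w                             ≡⟨ cong (Q._* conv (∂ a f) g w) (sgn-+ (suc a) (dg w)) ⟩
      (sgn (suc a) Q.* sgn (dg w)) Q.* conv (∂ a f) g w  ≡⟨ QP.*-assoc (sgn (suc a)) (sgn (dg w)) (conv (∂ a f) g w) ⟩
      sgn (suc a) Q.* θ (conv (∂ a f) g) w               ≡⟨ cong (sgn (suc a) Q.*_) (θ-conv (∂ a f) g w) ⟩
      sgn (suc a) Q.* conv (θ (∂ a f)) (θ g) w           ≡⟨ sym (conv-scaleˡ (sgn (suc a)) (θ (∂ a f)) (θ g) w) ⟩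
      conv (sgn (suc a) ⋆ θ (∂ a f)) (θ g) w             ≡⟨ sym (conv-cong (θ-∂ a f) (λ _ → refl) w) ⟩
      conv (∂ a (θ f)) (θ g) w                           ∎

θ-spow : ∀ f m → θ (spow f m) ≗ spow (θ f) m
θ-spow f zero = θ-δ
θ-spow f (suc m) w = trans (θ-conv f (spow f m) w) (conv-cong (λ _ → refl) (θ-spow f m) w)

θ-ssum : ∀ fs → θ (ssum fs) ≗ ssum (map θ fs)
θ-ssum [] w = QP.*-zeroʳ (sgn (dg w))
θ-ssum (f ∷ fs) w = trans (QP.*-distribˡ-+ (sgn (dg w)) (f w) (ssum fs w)) (cong (θ f w Q.+_) (θ-ssum fs w))

θ-sprod : ∀ fs → θ (sprod fs) ≗ sprod (map θ fs)
θ-sprod [] = θ-δ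
θ-sprod (f ∷ fs) w = trans (θ-conv f (sprod fs) w) (conv-cong (λ _ → refl) (θ-sprod fs) w)

θ-sexp : ∀ N f → θ (sexp N f) ≗ sexp N (θ f)
θ-sexp N f w = begin
    θ (sexp N f) w                                    ≡⟨ θ-ssum (map T (upTo (suc N))) w ⟩
    ssum (map θ (map T (upTo (suc N)))) w              ≡⟨ cong (λ q → ssum q w) (sym (LP.map-∘ {g = θ} {f = T} (upTo (suc N)))) ⟩
    ssum (map (θ ∘ T) (upTo (suc N))) w                ≡⟨ ssum-map-cong (θ ∘ T) (λ m → invFact m ⋆ spow (θ f) m) (upTo (suc N))
                                                           (All.universal termwise (upTo (suc N))) w ⟩
    sexp N (θ f) w                                    ∎
  where
  open ≡-Reasoning
  T : ℕ → Ser
  T m = invFact m ⋆ spow f m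
  termwise : ∀ m → θ (T m) ≗ invFact m ⋆ spow (θ f) m
  termwise m w' = trans (θ-⋆ (invFact m) (spow f m) w') (cong (invFact m Q.*_) (θ-spow f m w'))

θ-homogeneous : ∀ k x → (∀ w → dg w ≢ k → x w ≡ 0ℚ) → θ x ≗ sgn k ⋆ x
θ-homogeneous k x h w with dg w ℕ.≟ k
... | yes e = cong (λ d → sgn d Q.* x w) e
... | no ne = begin
    sgn (dg w) Q.* x w  ≡⟨ cong (sgn (dg w) Q.*_) (h w ne) ⟩
    sgn (dg w) Q.* 0ℚ   ≡⟨ QP.*-zeroʳ (sgn (dg w)) ⟩
    0ℚ                  ≡⟨ sym (QP.*-zeroʳ (sgn k)) ⟩
    sgn k Q.* 0ℚ        ≡⟨ cong (sgn k Q.*_) (sym (h w ne)) ⟩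
    sgn k Q.* x w       ∎
  where open ≡-Reasoning

-- exp(−x)·exp(x) = 1 for x of positive order
--
-- Both exponentials are polynomials in x; their product is the polynomial with coefficients
-- Σ_{a+b=i} (−1)ᵃ/(a! b!), which vanish for 1 ≤ i ≤ N (the alternating binomial sum).

toℚ : ℕ → ℚ
toℚ n = + n Q./ 1

-- Rational identities are proved through unnormalised rationals, where they are integer identities.
/-as-fromℚᵘ : ∀ i n .{{_ : NonZero n}} → i Q./ n ≡ Q.fromℚᵘ (mkℚᵘ i (ℕ.pred n))
/-as-fromℚᵘ i n = QP./-cong {p₁ = i} {p₂ = i} refl (sym (NP.suc-pred n))

fromℚᵘ-* : ∀ x y z → x U.* y U.≃ z → Q.fromℚᵘ x Q.* Q.fromℚᵘ y ≡ Q.fromℚᵘ z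
fromℚᵘ-* x y z e = QP.toℚᵘ-injective (UP.≃-trans (QP.toℚᵘ-homo-* (Q.fromℚᵘ x) (Q.fromℚᵘ y))
   (UP.≃-trans (UP.*-cong (QP.toℚᵘ-fromℚᵘ x) (QP.toℚᵘ-fromℚᵘ y)) (UP.≃-trans e (UP.≃-sym (QP.toℚᵘ-fromℚᵘ z)))))

fromℚᵘ-+ : ∀ x y z → x U.+ y U.≃ z → Q.fromℚᵘ x Q.+ Q.fromℚᵘ y ≡ Q.fromℚᵘ z
fromℚᵘ-+ x y z e = QP.toℚᵘ-injective (UP.≃-trans (QP.toℚᵘ-homo-+ (Q.fromℚᵘ x) (Q.fromℚᵘ y))
   (UP.≃-trans (UP.+-cong (QP.toℚᵘ-fromℚᵘ x) (QP.toℚᵘ-fromℚᵘ y)) (UP.≃-trans e (UP.≃-sym (QP.toℚᵘ-fromℚᵘ z)))))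

toℚ-*-1/ : ∀ n d .{{_ : NonZero n}} .{{_ : NonZero d}} → toℚ n Q.* ((+ 1 Q./ (n ℕ.* d)) {{NP.m*n≢0 n d}}) ≡ + 1 Q./ d
toℚ-*-1/ n d = trans (cong (toℚ n Q.*_) (/-as-fromℚᵘ (+ 1) (n ℕ.* d) {{NP.m*n≢0 n d}}))
  (trans (fromℚᵘ-* (mkℚᵘ (+ n) 0) (mkℚᵘ (+ 1) (ℕ.pred (n ℕ.* d))) (mkℚᵘ (+ 1) (ℕ.pred d)) (*≡* cross)) (sym (/-as-fromℚᵘ (+ 1) d)))
  where
  instance nd = NP.m*n≢0 n d
  cross : (+ n ℤ.* + 1) ℤ.* + suc (ℕ.pred d) ≡ + 1 ℤ.* + suc (ℕ.pred (n ℕ.* d) ℕ.+ 0)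
  cross = begin
      (+ n ℤ.* + 1) ℤ.* + suc (ℕ.pred d)       ≡⟨ cong₂ ℤ._*_ (ℤP.*-identityʳ (+ n)) (cong +_ (NP.suc-pred d)) ⟩
      + n ℤ.* + d                              ≡⟨ sym (ℤP.pos-* n d) ⟩
      + (n ℕ.* d)                              ≡⟨ cong +_ (sym (NP.suc-pred (n ℕ.* d))) ⟩
      + suc (ℕ.pred (n ℕ.* d))                 ≡⟨ cong (λ k → + suc k) (sym (NP.+-identityʳ _)) ⟩
      + suc (ℕ.pred (n ℕ.* d) ℕ.+ 0)           ≡⟨ sym (ℤP.*-identityˡ _) ⟩
      + 1 ℤ.* + suc (ℕ.pred (n ℕ.* d) ℕ.+ 0)   ∎
    where open ≡-Reasoning

toℚ-*-invFact : ∀ m → toℚ (suc m) Q.* invFact (suc m) ≡ invFact m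
toℚ-*-invFact m = toℚ-*-1/ (suc m) (m !) {{_}} {{m NP.!≢0}}

toℚ-+ : ∀ a b → toℚ (a ℕ.+ b) ≡ toℚ a Q.+ toℚ b
toℚ-+ a b = sym (fromℚᵘ-+ (mkℚᵘ (+ a) 0) (mkℚᵘ (+ b) 0) (mkℚᵘ (+ (a ℕ.+ b)) 0) (*≡* cross))
  where
  cross : (+ a ℤ.* + 1 ℤ.+ + b ℤ.* + 1) ℤ.* + 1 ≡ + (a ℕ.+ b) ℤ.* + 1
  cross = begin
      (+ a ℤ.* + 1 ℤ.+ + b ℤ.* + 1) ℤ.* + 1   ≡⟨ ℤP.*-identityʳ _ ⟩
      + a ℤ.* + 1 ℤ.+ + b ℤ.* + 1             ≡⟨ cong₂ ℤ._+_ (ℤP.*-identityʳ (+ a)) (ℤP.*-identityʳ (+ b)) ⟩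
      + a ℤ.+ + b                             ≡⟨ sym (ℤP.pos-+ a b) ⟩
      + (a ℕ.+ b)                             ≡⟨ sym (ℤP.*-identityʳ _) ⟩
      + (a ℕ.+ b) ℤ.* + 1                     ∎
    where open ≡-Reasoning

toℚ-suc-*-cancel : ∀ k x → toℚ (suc k) Q.* x ≡ 0ℚ → x ≡ 0ℚ
toℚ-suc-*-cancel k x e = begin
    x                            ≡⟨ sym (QP.*-identityˡ x) ⟩
    1ℚ Q.* x                     ≡⟨ cong (Q._* x) (sym inverse) ⟩
    (toℚ (suc k) Q.* y) Q.* x    ≡⟨ solve 3 (λ a b c → (a :* b) :* c := b :* (a :* c)) refl (toℚ (suc k)) y x ⟩
    y Q.* (toℚ (suc k) Q.* x)    ≡⟨ cong (y Q.*_) e ⟩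
    y Q.* 0ℚ                     ≡⟨ QP.*-zeroʳ y ⟩
    0ℚ                           ∎
  where
  open ≡-Reasoning
  y = + 1 Q./ suc k
  inverse : toℚ (suc k) Q.* y ≡ 1ℚ
  inverse = trans (cong (toℚ (suc k) Q.*_) (QP./-cong {p₁ = + 1} {p₂ = + 1} {{_}} {{NP.m*n≢0 (suc k) 1}} refl
                    (sym (NP.*-identityʳ (suc k))))) (toℚ-*-1/ (suc k) 1)

sumTo : ℕ → (ℕ → ℚ) → ℚ
sumTo zero h = h 0
sumTo (suc i) h = h 0 Q.+ sumTo i (h ∘ suc)

sumTo-suc : ∀ i h → sumTo (suc i) h ≡ sumTo i h Q.+ h (suc i)
sumTo-suc zero h = refl
sumTo-suc (suc i) h = trans (cong (h 0 Q.+_) (sumTo-suc i (h ∘ suc))) (sym (QP.+-assoc (h 0) _ _))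

sumTo-cong : ∀ i h h' → (∀ a → a ≤ i → h a ≡ h' a) → sumTo i h ≡ sumTo i h'
sumTo-cong zero h h' e = e 0 z≤n
sumTo-cong (suc i) h h' e = cong₂ Q._+_ (e 0 z≤n) (sumTo-cong i (h ∘ suc) (h' ∘ suc) (λ a le → e (suc a) (s≤s le)))

binomTerm : ℕ → ℕ → ℚ
binomTerm m a = sgn a Q.* (invFact a Q.* invFact (m ∸ a))

∸-suc : ∀ k a → a < k → k ∸ a ≡ suc (k ∸ suc a)
∸-suc (suc k) zero _ = refl
∸-suc (suc k) (suc a) (s≤s lt) = ∸-suc k a lt

binom-partialSum : ∀ k a → a ≤ k → toℚ (suc k) Q.* sumTo a (binomTerm (suc k)) ≡ binomTerm k a
binom-partialSum k zero _ = trans (cong (toℚ (suc k) Q.*_) (trans (QP.*-identityˡ _) (QP.*-identityˡ _)))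
                  (trans (toℚ-*-invFact k) (sym (trans (QP.*-identityˡ _) (QP.*-identityˡ _))))
binom-partialSum k (suc a) lt = begin
    toℚ (suc k) Q.* sumTo (suc a) (binomTerm (suc k))
  ≡⟨ cong (toℚ (suc k) Q.*_) (sumTo-suc a (binomTerm (suc k))) ⟩
    toℚ (suc k) Q.* (sumTo a (binomTerm (suc k)) Q.+ binomTerm (suc k) (suc a))
  ≡⟨ QP.*-distribˡ-+ (toℚ (suc k)) _ _ ⟩
    toℚ (suc k) Q.* sumTo a (binomTerm (suc k)) Q.+ toℚ (suc k) Q.* binomTerm (suc k) (suc a)
  ≡⟨ cong₂ Q._+_ (binom-partialSum k a (NP.≤-trans (NP.n≤1+n a) lt)) refl ⟩
    s Q.* (invFact a Q.* invFact (k ∸ a)) Q.+ toℚ (suc k) Q.* (sgn (suc a) Q.* (Fa Q.* invFact (k ∸ a)))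
  ≡⟨ cong (λ z → s Q.* (invFact a Q.* invFact z) Q.+ toℚ (suc k) Q.* (sgn (suc a) Q.* (Fa Q.* invFact z))) k∸a ⟩
    s Q.* (invFact a Q.* Fb) Q.+ toℚ (suc k) Q.* (sgn (suc a) Q.* (Fa Q.* Fb))
  ≡⟨ cong₃ (λ z t r → s Q.* (z Q.* Fb) Q.+ t Q.* (r Q.* (Fa Q.* Fb))) (sym (toℚ-*-invFact a)) k+1 (sgn-suc a) ⟩
    s Q.* ((toℚ (suc a) Q.* Fa) Q.* Fb) Q.+ (toℚ (suc a) Q.+ toℚ (suc b)) Q.* (Q.- s Q.* (Fa Q.* Fb))
  ≡⟨ solve 5 (λ s p q F G → s :* ((p :* F) :* G) :+ (p :+ q) :* ((:- s) :* (F :* G)) := (:- s) :* (F :* (q :* G))) refl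
        s (toℚ (suc a)) (toℚ (suc b)) Fa Fb ⟩
    Q.- s Q.* (Fa Q.* (toℚ (suc b) Q.* Fb))
  ≡⟨ cong₂ (λ z t → z Q.* (Fa Q.* t)) (sym (sgn-suc a)) (toℚ-*-invFact b) ⟩
    sgn (suc a) Q.* (Fa Q.* invFact b)
  ∎
  where
  open ≡-Reasoning
  s = sgn a
  b = k ∸ suc a
  Fa = invFact (suc a)
  Fb = invFact (suc b)
  k∸a : k ∸ a ≡ suc b
  k∸a = ∸-suc k a lt
  k+1 : toℚ (suc k) ≡ toℚ (suc a) Q.+ toℚ (suc b)
  k+1 = trans (cong (λ z → toℚ (suc z)) (trans (sym (NP.m+[n∸m]≡n (NP.≤-trans (NP.n≤1+n a) lt))) (cong (a ℕ.+_) k∸a)))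
              (toℚ-+ (suc a) (suc b))
  cong₃ : ∀ {x x' y y' z z'} (f : ℚ → ℚ → ℚ → ℚ) → x ≡ x' → y ≡ y' → z ≡ z' → f x y z ≡ f x' y' z'
  cong₃ f refl refl refl = refl

alternating-binomial-sum : ∀ k → sumTo (suc k) (binomTerm (suc k)) ≡ 0ℚ
alternating-binomial-sum k = toℚ-suc-*-cancel k _ (begin
    toℚ (suc k) Q.* sumTo (suc k) (binomTerm (suc k))
  ≡⟨ cong (toℚ (suc k) Q.*_) (sumTo-suc k (binomTerm (suc k))) ⟩
    toℚ (suc k) Q.* (sumTo k (binomTerm (suc k)) Q.+ binomTerm (suc k) (suc k))
  ≡⟨ QP.*-distribˡ-+ (toℚ (suc k)) _ _ ⟩
    toℚ (suc k) Q.* sumTo k (binomTerm (suc k)) Q.+ toℚ (suc k) Q.* binomTerm (suc k) (suc k)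
  ≡⟨ cong₂ Q._+_ (binom-partialSum k k NP.≤-refl) refl ⟩
    sgn k Q.* (invFact k Q.* invFact (k ∸ k)) Q.+ toℚ (suc k) Q.* (sgn (suc k) Q.* (invFact (suc k) Q.* invFact (k ∸ k)))
  ≡⟨ cong (λ z → sgn k Q.* (invFact k Q.* invFact z) Q.+ toℚ (suc k) Q.* (sgn (suc k) Q.* (invFact (suc k) Q.* invFact z))) (NP.n∸n≡0 k) ⟩
    sgn k Q.* (invFact k Q.* 1ℚ) Q.+ toℚ (suc k) Q.* (sgn (suc k) Q.* (invFact (suc k) Q.* 1ℚ))
  ≡⟨ cong₂ (λ z t → sgn k Q.* (z Q.* 1ℚ) Q.+ toℚ (suc k) Q.* (t Q.* (invFact (suc k) Q.* 1ℚ))) (sym (toℚ-*-invFact k)) (sgn-suc k) ⟩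
    sgn k Q.* ((toℚ (suc k) Q.* invFact (suc k)) Q.* 1ℚ) Q.+ toℚ (suc k) Q.* (Q.- sgn k Q.* (invFact (suc k) Q.* 1ℚ))
  ≡⟨ solve 3 (λ s p F → s :* ((p :* F) :* con 1ℚ) :+ p :* ((:- s) :* (F :* con 1ℚ)) := con 0ℚ) refl (sgn k) (toℚ (suc k)) (invFact (suc k)) ⟩
    0ℚ
  ∎)
  where open ≡-Reasoning

UPoly : Set
UPoly = List ℚ

peval : UPoly → Ser → Ser
peval [] x = zS
peval (c ∷ cs) x = c ⋆ δ ⊹ conv x (peval cs x)

padd : UPoly → UPoly → UPoly
padd [] q = q
padd (a ∷ p) [] = a ∷ p
padd (a ∷ p) (b ∷ q) = (a Q.+ b) ∷ padd p q

pscale : ℚ → UPoly → UPoly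
pscale c = map (c Q.*_)

pmul : UPoly → UPoly → UPoly
pmul [] q = []
pmul (c ∷ p) q = padd (pscale c q) (0ℚ ∷ pmul p q)

pcoef : UPoly → ℕ → ℚ
pcoef [] i = 0ℚ
pcoef (c ∷ cs) zero = c
pcoef (c ∷ cs) (suc i) = pcoef cs i

peval-padd : ∀ p q x → peval (padd p q) x ≗ peval p x ⊹ peval q x
peval-padd [] q x w = sym (QP.+-identityˡ _)
peval-padd (a ∷ p) [] x w = sym (QP.+-identityʳ _)
peval-padd (a ∷ p) (b ∷ q) x w = begin
    (a Q.+ b) Q.* δ w Q.+ conv x (peval (padd p q) x) w
  ≡⟨ cong ((a Q.+ b) Q.* δ w Q.+_) (trans (conv-cong (λ _ → refl) (peval-padd p q x) w) (conv-distribˡ x (peval p x) (peval q x) w)) ⟩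
    (a Q.+ b) Q.* δ w Q.+ (conv x (peval p x) w Q.+ conv x (peval q x) w)
  ≡⟨ solve 5 (λ a b d u v → (a :+ b) :* d :+ (u :+ v) := (a :* d :+ u) :+ (b :* d :+ v)) refl a b (δ w) (conv x (peval p x) w) (conv x (peval q x) w) ⟩
    (a Q.* δ w Q.+ conv x (peval p x) w) Q.+ (b Q.* δ w Q.+ conv x (peval q x) w)
  ∎
  where open ≡-Reasoning

peval-pscale : ∀ c q x → peval (pscale c q) x ≗ c ⋆ peval q x
peval-pscale c [] x w = sym (QP.*-zeroʳ c)
peval-pscale c (b ∷ q) x w = begin
    (c Q.* b) Q.* δ w Q.+ conv x (peval (pscale c q) x) w
  ≡⟨ cong ((c Q.* b) Q.* δ w Q.+_) (trans (conv-cong (λ _ → refl) (peval-pscale c q x) w) (conv-scaleʳ c x (peval q x) w)) ⟩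
    (c Q.* b) Q.* δ w Q.+ c Q.* conv x (peval q x) w
  ≡⟨ solve 4 (λ c b d u → (c :* b) :* d :+ c :* u := c :* (b :* d :+ u)) refl c b (δ w) (conv x (peval q x) w) ⟩
    c Q.* (b Q.* δ w Q.+ conv x (peval q x) w)
  ∎
  where open ≡-Reasoning

peval-pmul : ∀ p q x → peval (pmul p q) x ≗ conv (peval p x) (peval q x)
peval-pmul [] q x w = sym (conv-zeroˡ (peval q x) w)
peval-pmul (c ∷ p) q x w = begin
    peval (padd (pscale c q) (0ℚ ∷ pmul p q)) x w
  ≡⟨ peval-padd (pscale c q) (0ℚ ∷ pmul p q) x w ⟩
    peval (pscale c q) x w Q.+ (0ℚ Q.* δ w Q.+ conv x (peval (pmul p q) x) w)
  ≡⟨ cong₂ Q._+_ (peval-pscale c q x w)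
       (trans (cong (Q._+ conv x (peval (pmul p q) x) w) (QP.*-zeroˡ (δ w)))
         (trans (QP.+-identityˡ _) (conv-cong (λ _ → refl) (peval-pmul p q x) w))) ⟩
    c Q.* peval q x w Q.+ conv x (conv (peval p x) (peval q x)) w
  ≡⟨ cong₂ Q._+_ (cong (c Q.*_) (sym (conv-identityˡ (peval q x) w))) (sym (conv-assoc x (peval p x) (peval q x) w)) ⟩
    c Q.* conv δ (peval q x) w Q.+ conv (conv x (peval p x)) (peval q x) w
  ≡⟨ cong (Q._+ conv (conv x (peval p x)) (peval q x) w) (sym (conv-scaleˡ c δ (peval q x) w)) ⟩
    conv (c ⋆ δ) (peval q x) w Q.+ conv (conv x (peval p x)) (peval q x) w
  ≡⟨ sym (conv-distribʳ (c ⋆ δ) (conv x (peval p x)) (peval q x) w) ⟩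
    conv (peval (c ∷ p) x) (peval q x) w
  ∎
  where open ≡-Reasoning

pcoef-padd : ∀ p q i → pcoef (padd p q) i ≡ pcoef p i Q.+ pcoef q i
pcoef-padd [] q i = sym (QP.+-identityˡ _)
pcoef-padd (a ∷ p) [] zero = sym (QP.+-identityʳ _)
pcoef-padd (a ∷ p) [] (suc i) = sym (QP.+-identityʳ _)
pcoef-padd (a ∷ p) (b ∷ q) zero = refl
pcoef-padd (a ∷ p) (b ∷ q) (suc i) = pcoef-padd p q i

pcoef-pscale : ∀ c q i → pcoef (pscale c q) i ≡ c Q.* pcoef q i
pcoef-pscale c [] i = sym (QP.*-zeroʳ c)
pcoef-pscale c (b ∷ q) zero = refl
pcoef-pscale c (b ∷ q) (suc i) = pcoef-pscale c q i

pcoef-pmul : ∀ p q i → pcoef (pmul p q) i ≡ sumTo i (λ a → pcoef p a Q.* pcoef q (i ∸ a))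
pcoef-pmul [] q zero = sym (QP.*-zeroˡ (pcoef q 0))
pcoef-pmul [] q (suc i) = sym (trans (cong (Q._+ sumTo i (λ a → pcoef [] a Q.* pcoef q (i ∸ a))) (QP.*-zeroˡ (pcoef q (suc i))))
   (trans (QP.+-identityˡ _) (sym (pcoef-pmul [] q i))))
pcoef-pmul (c ∷ p) q zero =
  trans (pcoef-padd (pscale c q) (0ℚ ∷ pmul p q) zero) (trans (cong (Q._+ 0ℚ) (pcoef-pscale c q zero)) (QP.+-identityʳ _))
pcoef-pmul (c ∷ p) q (suc i) = trans (pcoef-padd (pscale c q) (0ℚ ∷ pmul p q) (suc i))
  (cong₂ Q._+_ (pcoef-pscale c q (suc i)) (pcoef-pmul p q i))

pcoef-applyUpTo : ∀ (f : ℕ → ℚ) (g : ℕ → ℕ) n a → a < n → pcoef (map f (L.applyUpTo g n)) a ≡ f (g a)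
pcoef-applyUpTo f g (suc n) zero lt = refl
pcoef-applyUpTo f g (suc n) (suc a) (s≤s lt) = pcoef-applyUpTo f (g ∘ suc) n a lt

Van-peval : ∀ x → Van 1 x → ∀ K p → (∀ i → i < K → pcoef p i ≡ 0ℚ) → Van K (peval p x)
Van-peval x hx zero p h w ()
Van-peval x hx (suc K) [] h w lt = refl
Van-peval x hx (suc K) (c ∷ cs) h w lt =
  trans (cong₂ Q._+_ (trans (cong (Q._* δ w) (h 0 (s≤s z≤n))) (QP.*-zeroˡ (δ w)))
                     (conv-van 1 K hx (Van-peval x hx K cs (λ i lt' → h (suc i) (s≤s lt'))) w lt))
        (QP.+-identityˡ 0ℚ)

peval-near-one : ∀ x → Van 1 x → ∀ N p → pcoef p 0 ≡ 1ℚ → (∀ i → 1 ≤ i → i ≤ N → pcoef p i ≡ 0ℚ) →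
  Agree N (peval p x) δ
peval-near-one x hx N [] () h w le
peval-near-one x hx N (c ∷ cs) h0 h w le =
  trans (cong₂ Q._+_ (trans (cong (Q._* δ w) h0) (QP.*-identityˡ (δ w)))
                     (conv-van 1 N hx (Van-peval x hx N cs (λ i lt → h (suc i) (s≤s z≤n) lt)) w (s≤s le)))
        (QP.+-identityʳ (δ w))

ssum-powers-peval : ∀ (f : ℕ → ℚ) x n → ssum (map (λ m → f m ⋆ spow x m) (upTo n)) ≗ peval (map f (upTo n)) x
ssum-powers-peval f x zero w = refl
ssum-powers-peval f x (suc n) w = cong (f 0 Q.* δ w Q.+_) (begin
    ssum (map F (L.applyUpTo suc n)) w
  ≡⟨ cong (λ z → ssum z w) (shift F) ⟩
    ssum (map (F ∘ suc) (upTo n)) w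
  ≡⟨ ssum-map-cong (F ∘ suc) (λ m → conv x (f (suc m) ⋆ spow x m)) (upTo n)
       (All.universal (λ m w' → sym (conv-scaleʳ (f (suc m)) x (spow x m) w')) (upTo n)) w ⟩
    ssum (map (λ m → conv x (f (suc m) ⋆ spow x m)) (upTo n)) w
  ≡⟨ cong (λ z → ssum z w) (LP.map-∘ (upTo n)) ⟩
    ssum (map (conv x) (map (λ m → f (suc m) ⋆ spow x m) (upTo n))) w
  ≡⟨ sym (conv-ssum x (map (λ m → f (suc m) ⋆ spow x m) (upTo n)) w) ⟩
    conv x (ssum (map (λ m → f (suc m) ⋆ spow x m) (upTo n))) w
  ≡⟨ conv-cong (λ _ → refl) (ssum-powers-peval (f ∘ suc) x n) w ⟩
    conv x (peval (map (f ∘ suc) (upTo n)) x) w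
  ≡⟨ cong (λ z → conv x (peval z x) w) (sym (shift f)) ⟩
    conv x (peval (map f (L.applyUpTo suc n)) x) w
  ∎)
  where
  open ≡-Reasoning
  F : ℕ → Ser
  F m = f m ⋆ spow x m
  shift : ∀ {X : Set} (G : ℕ → X) → map G (L.applyUpTo suc n) ≡ map (G ∘ suc) (upTo n)
  shift G = trans (LP.map-applyUpTo suc G n) (sym (LP.map-upTo (G ∘ suc) n))

negS : Ser → Ser
negS x = Q.- 1ℚ ⋆ x

spow-neg : ∀ x m → spow (negS x) m ≗ sgn m ⋆ spow x m
spow-neg x zero w = sym (QP.*-identityˡ (δ w))
spow-neg x (suc m) w = begin
    conv (negS x) (spow (negS x) m) w                ≡⟨ conv-cong (λ _ → refl) (spow-neg x m) w ⟩
    conv (negS x) (sgn m ⋆ spow x m) w               ≡⟨ conv-scaleˡ (Q.- 1ℚ) x (sgn m ⋆ spow x m) w ⟩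
    Q.- 1ℚ Q.* conv x (sgn m ⋆ spow x m) w           ≡⟨ cong (Q.- 1ℚ Q.*_) (conv-scaleʳ (sgn m) x (spow x m) w) ⟩
    Q.- 1ℚ Q.* (sgn m Q.* conv x (spow x m) w)       ≡⟨ solve 2 (λ s c → (:- con 1ℚ) :* (s :* c) := (:- s) :* c) refl (sgn m) (conv x (spow x m) w) ⟩
    Q.- sgn m Q.* conv x (spow x m) w                ≡⟨ cong (Q._* conv x (spow x m) w) (sym (sgn-suc m)) ⟩
    sgn (suc m) Q.* conv x (spow x m) w              ∎
  where open ≡-Reasoning

sexp-neg-inverse : ∀ N x → Van 1 x → Agree N (conv (sexp N (negS x)) (sexp N x)) δ
sexp-neg-inverse N x hx = Agree-trans (≗⇒Agree as-peval) (peval-near-one x hx N P refl vanishing)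
  where
  Em Ep P : UPoly
  Em = map (λ m → sgn m Q.* invFact m) (upTo (suc N))
  Ep = map invFact (upTo (suc N))
  P = pmul Em Ep
  negative : sexp N (negS x) ≗ peval Em x
  negative w = trans (ssum-map-cong (λ m → invFact m ⋆ spow (negS x) m) (λ m → (sgn m Q.* invFact m) ⋆ spow x m) (upTo (suc N))
      (All.universal (λ m w' → trans (cong (invFact m Q.*_) (spow-neg x m w'))
                                 (solve 3 (λ a b c → a :* (b :* c) := (b :* a) :* c) refl (invFact m) (sgn m) (spow x m w')))
         (upTo (suc N))) w)
    (ssum-powers-peval (λ m → sgn m Q.* invFact m) x (suc N) w)
  as-peval : conv (sexp N (negS x)) (sexp N x) ≗ peval P x
  as-peval w = trans (conv-cong negative (ssum-powers-peval invFact x (suc N)) w) (sym (peval-pmul Em Ep x w))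
  vanishing : ∀ i → 1 ≤ i → i ≤ N → pcoef P i ≡ 0ℚ
  vanishing (suc k) _ le = begin
      pcoef P (suc k)                                                ≡⟨ pcoef-pmul Em Ep (suc k) ⟩
      sumTo (suc k) (λ a → pcoef Em a Q.* pcoef Ep (suc k ∸ a))      ≡⟨ sumTo-cong (suc k) _ (binomTerm (suc k)) terms ⟩
      sumTo (suc k) (binomTerm (suc k))                              ≡⟨ alternating-binomial-sum k ⟩
      0ℚ                                                             ∎
    where
    open ≡-Reasoning
    terms : ∀ a → a ≤ suc k → pcoef Em a Q.* pcoef Ep (suc k ∸ a) ≡ binomTerm (suc k) a
    terms a la = trans (cong₂ Q._*_
        (pcoef-applyUpTo (λ m → sgn m Q.* invFact m) id (suc N) a (s≤s (NP.≤-trans la le)))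
        (pcoef-applyUpTo invFact id (suc N) (suc k ∸ a) (s≤s (NP.≤-trans (NP.m∸n≤m (suc k) a) le))))
      (QP.*-assoc (sgn a) (invFact a) (invFact (suc k ∸ a)))

-- The series of Λ and the inverse of θ(σ₁)
--
-- In Sym, Λ_n = Σ_{deg w = n} (−1)^{n−ℓ(w)} S^w.  Hence Σ_n Λ_n is the series
-- ε(w) = (−1)^{deg w + ℓ(w)}, which is invariant under reversal of words and is the inverse of
-- θ(σ₁) = Σ_n (−1)ⁿ S_n.

ssum-single : ∀ (F : ℕ → Ser) w a → (∀ j → j ≢ a → F j w ≡ 0ℚ) → ∀ K →
  ssum (map F (upTo K)) w ≡ when (does (a ℕ.<? K)) (F a w)
ssum-single F w a h zero = refl
ssum-single F w a h (suc K) = begin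
    ssum (map F (upTo (suc K))) w                            ≡⟨ cong (λ z → ssum (map F z) w) (sym (LP.upTo-∷ʳ K)) ⟩
    ssum (map F (upTo K L.∷ʳ K)) w                           ≡⟨ cong (λ z → ssum z w) (LP.map-++ F (upTo K) (K ∷ [])) ⟩
    ssum (map F (upTo K) ++ F K ∷ []) w                      ≡⟨ ssum-++ (map F (upTo K)) (F K ∷ []) w ⟩
    ssum (map F (upTo K)) w Q.+ (F K w Q.+ 0ℚ)               ≡⟨ cong₂ Q._+_ (ssum-single F w a h K) (QP.+-identityʳ (F K w)) ⟩
    when (does (a ℕ.<? K)) (F a w) Q.+ F K w                 ≡⟨ last ⟩
    when (does (a ℕ.<? suc K)) (F a w)                       ∎
  where
  open ≡-Reasoning
  last : when (does (a ℕ.<? K)) (F a w) Q.+ F K w ≡ when (does (a ℕ.<? suc K)) (F a w)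
  last with K ℕ.≟ a
  ... | yes refl = trans (cong (Q._+ F K w) (when-no (K ℕ.<? K) (NP.<-irrefl refl) (F K w)))
                    (trans (QP.+-identityˡ (F K w)) (sym (when-yes (K ℕ.<? suc K) NP.≤-refl (F K w))))
  ... | no ne with a ℕ.<? K
  ...   | yes lt = trans (cong₂ Q._+_ (when-yes (a ℕ.<? K) lt (F a w)) (h K ne))
                     (trans (QP.+-identityʳ (F a w)) (sym (when-yes (a ℕ.<? suc K) (NP.m<n⇒m<1+n lt) (F a w))))
  ...   | no nlt = trans (cong₂ Q._+_ (when-no (a ℕ.<? K) nlt (F a w)) (h K ne))
                     (trans (QP.+-identityˡ 0ℚ)
                       (sym (when-no (a ℕ.<? suc K) (λ lt → nlt (NP.≤∧≢⇒< (NP.≤-pred lt) (λ e → ne (sym e)))) (F a w))))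

ε : Ser
ε w = sgn (dg w ℕ.+ length w)

ε-∂ : ∀ a → ∂ a ε ≗ (Q.- sgn (suc a)) ⋆ ε
ε-∂ a u = begin
    sgn ((suc a ℕ.+ dg u) ℕ.+ suc (length u))       ≡⟨ cong sgn (trans (NP.+-suc (suc a ℕ.+ dg u) (length u))
                                                                       (cong suc (NP.+-assoc (suc a) (dg u) (length u)))) ⟩
    sgn (suc (suc a ℕ.+ (dg u ℕ.+ length u)))       ≡⟨ sgn-suc (suc a ℕ.+ (dg u ℕ.+ length u)) ⟩
    Q.- sgn (suc a ℕ.+ (dg u ℕ.+ length u))         ≡⟨ cong Q.-_ (sgn-+ (suc a) (dg u ℕ.+ length u)) ⟩
    Q.- (sgn (suc a) Q.* ε u)                       ≡⟨ QP.neg-distribˡ-* (sgn (suc a)) (ε u) ⟩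
    Q.- sgn (suc a) Q.* ε u                         ∎
  where open ≡-Reasoning

σ∞ : Ser
σ∞ [] = 1ℚ
σ∞ (a ∷ []) = 1ℚ
σ∞ (a ∷ b ∷ w) = 0ℚ

ε-inverse-θσ : conv ε (θ σ∞) ≗ δ
ε-inverse-θσ [] = refl
ε-inverse-θσ (a ∷ w) = begin
    1ℚ Q.* θ σ∞ (a ∷ w) Q.+ conv (∂ a ε) (θ σ∞) w
  ≡⟨ cong (1ℚ Q.* θ σ∞ (a ∷ w) Q.+_) (trans (conv-cong (ε-∂ a) (λ _ → refl) w) (conv-scaleˡ (Q.- sgn (suc a)) ε (θ σ∞) w)) ⟩
    1ℚ Q.* θ σ∞ (a ∷ w) Q.+ Q.- sgn (suc a) Q.* conv ε (θ σ∞) w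
  ≡⟨ cong (λ z → 1ℚ Q.* θ σ∞ (a ∷ w) Q.+ Q.- sgn (suc a) Q.* z) (ε-inverse-θσ w) ⟩
    1ℚ Q.* θ σ∞ (a ∷ w) Q.+ Q.- sgn (suc a) Q.* δ w
  ≡⟨ cancels w ⟩
    0ℚ
  ∎
  where
  open ≡-Reasoning
  cancels : ∀ w → 1ℚ Q.* θ σ∞ (a ∷ w) Q.+ Q.- sgn (suc a) Q.* δ w ≡ 0ℚ
  cancels [] = begin
      1ℚ Q.* (sgn (suc a ℕ.+ 0) Q.* 1ℚ) Q.+ Q.- sgn (suc a) Q.* 1ℚ
    ≡⟨ cong (λ d → 1ℚ Q.* (sgn d Q.* 1ℚ) Q.+ Q.- sgn (suc a) Q.* 1ℚ) (NP.+-identityʳ (suc a)) ⟩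
      1ℚ Q.* (sgn (suc a) Q.* 1ℚ) Q.+ Q.- sgn (suc a) Q.* 1ℚ
    ≡⟨ solve 1 (λ s → con 1ℚ :* (s :* con 1ℚ) :+ (:- s) :* con 1ℚ := con 0ℚ) refl (sgn (suc a)) ⟩
      0ℚ ∎
  cancels (b ∷ w) = solve 2 (λ s t → con 1ℚ :* (t :* con 0ℚ) :+ (:- s) :* con 0ℚ := con 0ℚ) refl (sgn (suc a)) (sgn (dg (a ∷ b ∷ w)))

σ₁-agree : ∀ N → Agree N (cf (σ₁ N)) σ∞
σ₁-agree N w le = trans (cf-sumP-map S (cf ∘ S) (λ _ _ → refl) (upTo (suc N)) w) (go w le)
  where
  rest : ∀ w → ssum (map (cf ∘ S) (L.applyUpTo suc N)) w ≡ ssum (map (cf ∘ S ∘ suc) (upTo N)) w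
  rest w = cong (λ z → ssum z w) (trans (LP.map-applyUpTo suc (cf ∘ S) N) (sym (LP.map-upTo (cf ∘ S ∘ suc) N)))
  letter-no : ∀ j w → j ∷ [] ≢ w → cf (S (suc j)) w ≡ 0ℚ
  letter-no j w ne = trans (cf-letter j w) (mono-no 1ℚ (j ∷ []) w ne)
  go : ∀ w → dg w ≤ N → cf SymP.oneP w Q.+ ssum (map (cf ∘ S) (L.applyUpTo suc N)) w ≡ σ∞ w
  go [] _ = trans (cong (1ℚ Q.+_) (ssum-vanishing (cf ∘ S) [] suc (λ j → refl) N)) (QP.+-identityʳ 1ℚ)
  go (a ∷ []) le = begin
      0ℚ Q.+ ssum (map (cf ∘ S) (L.applyUpTo suc N)) (a ∷ [])      ≡⟨ trans (QP.+-identityˡ _) (rest (a ∷ [])) ⟩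
      ssum (map (cf ∘ S ∘ suc) (upTo N)) (a ∷ [])                   ≡⟨ ssum-single (cf ∘ S ∘ suc) (a ∷ []) a
                                                                         (λ j ne → letter-no j (a ∷ []) (λ e → ne (LP.∷-injectiveˡ e))) N ⟩
      when (does (a ℕ.<? N)) (cf (S (suc a)) (a ∷ []))              ≡⟨ when-yes (a ℕ.<? N) (NP.≤-trans (s≤s (NP.m≤m+n a 0)) le) _ ⟩
      cf (S (suc a)) (a ∷ [])                                       ≡⟨ trans (cf-letter a (a ∷ [])) (mono-yes 1ℚ (a ∷ [])) ⟩
      1ℚ                                                            ∎
    where open ≡-Reasoning
  go (a ∷ b ∷ w) _ = begin
      0ℚ Q.+ ssum (map (cf ∘ S) (L.applyUpTo suc N)) (a ∷ b ∷ w)   ≡⟨ trans (QP.+-identityˡ _) (rest (a ∷ b ∷ w)) ⟩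
      ssum (map (cf ∘ S ∘ suc) (upTo N)) (a ∷ b ∷ w)                ≡⟨ ssum-vanishing (cf ∘ S ∘ suc) (a ∷ b ∷ w) id
                                                                         (λ j → letter-no j (a ∷ b ∷ w) (λ ())) N ⟩
      0ℚ                                                            ∎
    where open ≡-Reasoning

ΛTerm : ℕ → SymPol → SymPol
ΛTerm k Λ = sgn k SymP.· (S k SymP.⊗ Λ)

ΛRevS : ℕ → List SymPol
ΛRevS zero = SymP.oneP ∷ []
ΛRevS (suc n) = SymP.neg (SymP.sumP (L.zipWith ΛTerm (oneTo (suc n)) (ΛRevS n))) ∷ ΛRevS n

ΛS : ℕ → SymPol
ΛS n = headOr SymP.zeroP (ΛRevS n)

λc : ℕ → Ser
λc n w = when (does (dg w ℕ.≟ n)) (ε w)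

antidiag : ℕ → (ℕ → ℕ → Ser) → List Ser
antidiag n H = L.zipWith H (oneTo (suc n)) (L.downFrom (suc n))

antidiag-suc : ∀ n H → antidiag (suc n) H ≡ H 1 (suc n) ∷ antidiag n (λ k i → H (suc k) i)
antidiag-suc n H = trans (cong (λ z → L.zipWith H z (L.downFrom (suc (suc n)))) oneTo-ss)
                         (cong (H 1 (suc n) ∷_) (zipWith-suc (oneTo (suc n)) (L.downFrom (suc n))))
  where
  oneTo-ss : oneTo (suc (suc n)) ≡ 1 ∷ map suc (oneTo (suc n))
  oneTo-ss = cong (λ z → 1 ∷ map suc z) (sym (LP.map-upTo suc (suc n)))
  zipWith-suc : ∀ xs ys → L.zipWith H (map suc xs) ys ≡ L.zipWith (λ k i → H (suc k) i) xs ys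
  zipWith-suc [] ys = refl
  zipWith-suc (x ∷ xs) [] = refl
  zipWith-suc (x ∷ xs) (y ∷ ys) = cong (H (suc x) y ∷_) (zipWith-suc xs ys)

ssum-antidiag-vanishing : ∀ n w (H : ℕ → ℕ → Ser) → (∀ j i → H (suc j) i w ≡ 0ℚ) → ssum (antidiag n H) w ≡ 0ℚ
ssum-antidiag-vanishing zero w H h = trans (cong (Q._+ 0ℚ) (h 0 0)) (QP.+-identityˡ 0ℚ)
ssum-antidiag-vanishing (suc n) w H h = trans (cong (λ z → ssum z w) (antidiag-suc n H))
  (trans (cong₂ Q._+_ (h 0 (suc n)) (ssum-antidiag-vanishing n w (λ k i → H (suc k) i) (λ j i → h (suc j) i)))
         (QP.+-identityˡ 0ℚ))

ssum-antidiag-single : ∀ n a w (c : ℕ → ℚ) (H : ℕ → ℕ → Ser) → (∀ j i → H (suc j) i w ≡ when (does (j ℕ.≟ a)) (c i)) →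
  ssum (antidiag n H) w ≡ when (does (a ℕ.≤? n)) (c (n ∸ a))
ssum-antidiag-single zero zero w c H h = trans (cong (Q._+ 0ℚ) (h 0 0)) (QP.+-identityʳ _)
ssum-antidiag-single zero (suc a) w c H h = trans (cong (Q._+ 0ℚ) (h 0 0)) (QP.+-identityʳ _)
ssum-antidiag-single (suc n) zero w c H h = trans (cong (λ z → ssum z w) (antidiag-suc n H))
  (trans (cong₂ Q._+_ (h 0 (suc n)) (ssum-antidiag-vanishing n w (λ k i → H (suc k) i) (λ j i → h (suc j) i)))
         (QP.+-identityʳ _))
ssum-antidiag-single (suc n) (suc a) w c H h = trans (cong (λ z → ssum z w) (antidiag-suc n H))
  (trans (cong₂ Q._+_ (h 0 (suc n)) (ssum-antidiag-single n a w c (λ k i → H (suc k) i) (λ j i → h (suc j) i)))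
    (trans (QP.+-identityˡ _) (cong (λ b → when b (c (n ∸ a))) (does-⇔ (a ℕ.≤? n) (suc a ℕ.≤? suc n) s≤s NP.≤-pred))))

conv-letter : ∀ j g a u → conv (mono 1ℚ (j ∷ [])) g (a ∷ u) ≡ when (does (j ℕ.≟ a)) (g u)
conv-letter j g a u = trans (cong (Q._+ conv (∂ a (mono 1ℚ (j ∷ []))) g u) (QP.*-zeroˡ (g (a ∷ u))))
                             (trans (QP.+-identityˡ _) (rest (does (j ℕ.≟ a))))
  where
  rest : ∀ b → conv (λ v → when (b ∧ does ([] SymP.≟W v)) 1ℚ) g u ≡ when b (g u)
  rest true = trans (conv-cong {g = g} (λ v → trans (mono-[] 1ℚ v) (QP.*-identityˡ (δ v))) (λ _ → refl) u) (conv-identityˡ g u)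
  rest false = conv-zeroˡ g u

sgn-when : ∀ j a x → sgn (suc j) Q.* when (does (j ℕ.≟ a)) x ≡ when (does (j ℕ.≟ a)) (sgn (suc a) Q.* x)
sgn-when j a x with j ℕ.≟ a
... | yes refl = trans (cong (sgn (suc j) Q.*_) (when-yes (j ℕ.≟ j) refl x)) (sym (when-yes (j ℕ.≟ j) refl _))
... | no ne = trans (cong (sgn (suc j) Q.*_) (when-no (j ℕ.≟ a) ne x))
                (trans (QP.*-zeroʳ (sgn (suc j))) (sym (when-no (j ℕ.≟ a) ne _)))

λc-recursion : ∀ n a u → Q.- 1ℚ Q.* when (does (a ℕ.≤? n)) (sgn (suc a) Q.* λc (n ∸ a) u) ≡ λc (suc n) (a ∷ u)
λc-recursion n a u with a ℕ.≤? n
... | no a≰n = trans (cong (Q.- 1ℚ Q.*_) (when-no (a ℕ.≤? n) a≰n _)) (trans (QP.*-zeroʳ (Q.- 1ℚ))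
                (sym (when-no (dg (a ∷ u) ℕ.≟ suc n) (λ e → a≰n (NP.≤-trans (NP.m≤m+n a (dg u)) (NP.≤-pred (NP.≤-reflexive e)))) _)))
... | yes a≤n with dg u ℕ.≟ n ∸ a
...   | yes e = begin
        Q.- 1ℚ Q.* when (does (a ℕ.≤? n)) (s Q.* λc (n ∸ a) u)
      ≡⟨ cong (Q.- 1ℚ Q.*_) (when-yes (a ℕ.≤? n) a≤n _) ⟩
        Q.- 1ℚ Q.* (s Q.* when (does (dg u ℕ.≟ n ∸ a)) (ε u))
      ≡⟨ cong (λ z → Q.- 1ℚ Q.* (s Q.* z)) (when-yes (dg u ℕ.≟ n ∸ a) e (ε u)) ⟩
        Q.- 1ℚ Q.* (s Q.* ε u)
      ≡⟨ solve 2 (λ s x → (:- con 1ℚ) :* (s :* x) := (:- s) :* x) refl s (ε u) ⟩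
        Q.- s Q.* ε u
      ≡⟨ sym (ε-∂ a u) ⟩
        ε (a ∷ u)
      ≡⟨ sym (when-yes (dg (a ∷ u) ℕ.≟ suc n) (cong suc (trans (cong (a ℕ.+_) e) (NP.m+[n∸m]≡n a≤n))) (ε (a ∷ u))) ⟩
        λc (suc n) (a ∷ u)
      ∎
  where
  open ≡-Reasoning
  s = sgn (suc a)
...   | no ne = trans (cong (Q.- 1ℚ Q.*_) (trans (when-yes (a ℕ.≤? n) a≤n _)
                    (trans (cong (sgn (suc a) Q.*_) (when-no (dg u ℕ.≟ n ∸ a) ne (ε u))) (QP.*-zeroʳ (sgn (suc a))))))
                  (trans (QP.*-zeroʳ (Q.- 1ℚ))
                    (sym (when-no (dg (a ∷ u) ℕ.≟ suc n) (λ e → ne (trans (sym (NP.m+n∸m≡n a (dg u))) (cong (_∸ a) (NP.suc-injective e)))) _)))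

CoeffsΛ : List SymPol → List ℕ → Set
CoeffsΛ = Pointwise (λ p i → cf p ≗ λc i)

ΛTermSeries : ℕ → ℕ → Ser
ΛTermSeries k i = sgn k ⋆ conv (cf (S k)) (λc i)

cf-ΛTerms : ∀ ks {ps is} → CoeffsΛ ps is → cf (SymP.sumP (L.zipWith ΛTerm ks ps)) ≗ ssum (L.zipWith ΛTermSeries ks is)
cf-ΛTerms [] _ w = refl
cf-ΛTerms (k ∷ ks) [] w = refl
cf-ΛTerms (k ∷ ks) {p ∷ ps} (e ∷ es) w = trans (coeff-++ (ΛTerm k p) _ w)
  (cong₂ Q._+_ (trans (coeff-· (sgn k) (S k SymP.⊗ p) w) (cong (sgn k Q.*_) (trans (cf-⊗ (S k) p w) (conv-cong (λ _ → refl) e w))))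
               (cf-ΛTerms ks es w))

ΛTermSeries-letter : ∀ j i w → ΛTermSeries (suc j) i w ≡ sgn (suc j) Q.* conv (mono 1ℚ (j ∷ [])) (λc i) w
ΛTermSeries-letter j i w = cong (sgn (suc j) Q.*_) (conv-cong (cf-letter j) (λ _ → refl) w)

Λ-step : ∀ n → CoeffsΛ (ΛRevS n) (L.downFrom (suc n)) →
  cf (SymP.neg (SymP.sumP (L.zipWith ΛTerm (oneTo (suc n)) (ΛRevS n)))) ≗ λc (suc n)
Λ-step n IH [] = begin
    cf (SymP.neg X) []                            ≡⟨ coeff-· (Q.- 1ℚ) X [] ⟩
    Q.- 1ℚ Q.* cf X []                            ≡⟨ cong (Q.- 1ℚ Q.*_) (cfX []) ⟩
    Q.- 1ℚ Q.* ssum (antidiag n ΛTermSeries) []   ≡⟨ cong (Q.- 1ℚ Q.*_) (ssum-antidiag-vanishing n [] ΛTermSeries no-letter) ⟩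
    Q.- 1ℚ Q.* 0ℚ                                 ≡⟨ QP.*-zeroʳ (Q.- 1ℚ) ⟩
    0ℚ                                            ∎
  where
  open ≡-Reasoning
  X = SymP.sumP (L.zipWith ΛTerm (oneTo (suc n)) (ΛRevS n))
  cfX : cf X ≗ ssum (antidiag n ΛTermSeries)
  cfX = cf-ΛTerms (oneTo (suc n)) IH
  no-letter : ∀ j i → ΛTermSeries (suc j) i [] ≡ 0ℚ
  no-letter j i = trans (ΛTermSeries-letter j i [])
    (trans (cong (sgn (suc j) Q.*_) (QP.*-zeroˡ (λc i []))) (QP.*-zeroʳ (sgn (suc j))))
Λ-step n IH (a ∷ u) = begin
    cf (SymP.neg X) (a ∷ u)                                        ≡⟨ coeff-· (Q.- 1ℚ) X (a ∷ u) ⟩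
    Q.- 1ℚ Q.* cf X (a ∷ u)                                        ≡⟨ cong (Q.- 1ℚ Q.*_) (cfX (a ∷ u)) ⟩
    Q.- 1ℚ Q.* ssum (antidiag n ΛTermSeries) (a ∷ u)               ≡⟨ cong (Q.- 1ℚ Q.*_)
                                                                        (ssum-antidiag-single n a (a ∷ u) (λ i → sgn (suc a) Q.* λc i u) ΛTermSeries first-letter) ⟩
    Q.- 1ℚ Q.* when (does (a ℕ.≤? n)) (sgn (suc a) Q.* λc (n ∸ a) u) ≡⟨ λc-recursion n a u ⟩
    λc (suc n) (a ∷ u)                                             ∎
  where
  open ≡-Reasoning
  X = SymP.sumP (L.zipWith ΛTerm (oneTo (suc n)) (ΛRevS n))
  cfX : cf X ≗ ssum (antidiag n ΛTermSeries)
  cfX = cf-ΛTerms (oneTo (suc n)) IH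
  -- only the letter S_{a+1} can start the word a u
  first-letter : ∀ j i → ΛTermSeries (suc j) i (a ∷ u) ≡ when (does (j ℕ.≟ a)) (sgn (suc a) Q.* λc i u)
  first-letter j i = trans (ΛTermSeries-letter j i (a ∷ u))
    (trans (cong (sgn (suc j) Q.*_) (conv-letter j (λc i) a u)) (sgn-when j a (λc i u)))

ΛRevS-coeffs : ∀ n → CoeffsΛ (ΛRevS n) (L.downFrom (suc n))
ΛRevS-coeffs zero = one ∷ []
  where
  one : cf SymP.oneP ≗ λc 0
  one [] = refl
  one (a ∷ u) = refl
ΛRevS-coeffs (suc n) = Λ-step n (ΛRevS-coeffs n) ∷ ΛRevS-coeffs n

cf-ΛS : ∀ n → cf (ΛS n) ≗ λc n
cf-ΛS n with ΛRevS n | ΛRevS-coeffs n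
... | p ∷ _ | e ∷ _ = e

revP : SymPol → SymPol
revP p = map (λ t → (proj₁ t , reverse (proj₂ t))) p

cf-revP : ∀ p w → cf (revP p) w ≡ cf p (reverse w)
cf-revP [] w = refl
cf-revP ((c , u) ∷ p) w = trans (coeff-cons c (reverse u) (revP p) w)
  (trans (cong₂ Q._+_ (cong (when' c) (does-⇔ (reverse u SymP.≟W w) (u SymP.≟W reverse w)
            (λ e → trans (sym (LP.reverse-involutive u)) (cong reverse e))
            (λ e → trans (cong reverse e) (LP.reverse-involutive w)))) (cf-revP p w))
    (sym (coeff-cons c u p (reverse w))))
  where
  when' : ℚ → Bool → ℚ
  when' c b = when b c

dg-++ : ∀ xs ys → dg (xs ++ ys) ≡ dg xs ℕ.+ dg ys
dg-++ [] ys = refl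
dg-++ (x ∷ xs) ys = trans (cong (suc x ℕ.+_) (dg-++ xs ys)) (sym (NP.+-assoc (suc x) (dg xs) (dg ys)))

dg-reverse : ∀ w → dg (reverse w) ≡ dg w
dg-reverse [] = refl
dg-reverse (a ∷ w) = begin
    dg (reverse (a ∷ w))               ≡⟨ cong dg (LP.unfold-reverse a w) ⟩
    dg (reverse w ++ a ∷ [])           ≡⟨ dg-++ (reverse w) (a ∷ []) ⟩
    dg (reverse w) ℕ.+ (suc a ℕ.+ 0)   ≡⟨ cong₂ ℕ._+_ (dg-reverse w) (NP.+-identityʳ (suc a)) ⟩
    dg w ℕ.+ suc a                     ≡⟨ NP.+-comm (dg w) (suc a) ⟩
    dg (a ∷ w)                         ∎
  where open ≡-Reasoning

λc-reverse : ∀ n w → λc n (reverse w) ≡ λc n w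
λc-reverse n w rewrite dg-reverse w | LP.length-reverse w = refl

revΛsum : ℕ → Ser
revΛsum N = ssum (map (λ n → cf (revP (ΛS n))) (upTo (suc N)))

-- Λ_n sees only degree n, so the sum over n ≤ N is ε in degrees ≤ N
revΛsum-agree : ∀ N → Agree N (revΛsum N) ε
revΛsum-agree N w le = begin
    revΛsum N w
  ≡⟨ ssum-map-cong (λ n → cf (revP (ΛS n))) λc (upTo (suc N))
       (All.universal (λ n w' → trans (cf-revP (ΛS n) w') (trans (cf-ΛS n (reverse w')) (λc-reverse n w'))) (upTo (suc N))) w ⟩
    ssum (map λc (upTo (suc N))) w
  ≡⟨ ssum-single λc w (dg w) (λ j ne → when-no (dg w ℕ.≟ j) (λ e → ne (sym e)) (ε w)) (suc N) ⟩
    when (does (dg w ℕ.<? suc N)) (λc (dg w) w)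
  ≡⟨ when-yes (dg w ℕ.<? suc N) (s≤s le) _ ⟩
    λc (dg w) w
  ≡⟨ when-yes (dg w ℕ.≟ dg w) refl (ε w) ⟩
    ε w
  ∎
  where open ≡-Reasoning

revΛsum-inverse-θσ₁ : ∀ N → Agree N (conv (revΛsum N) (θ (cf (σ₁ N)))) δ
revΛsum-inverse-θσ₁ N = Agree-trans (conv-agree N (revΛsum-agree N) (θ-agree (σ₁-agree N))) (≗⇒Agree ε-inverse-θσ)

-- The projection π : MR → Sym
--
-- π forgets bars.  It commutes on the nose with every list operation of Defs, and its
-- coefficient in w is the sum of the coefficients of the 2^ℓ(w) lifts of w; hence π respects
-- truncation and homogeneity.

MWord : Set
MWord = List MRLetter

forgetBars : ℚ × MWord → ℚ × Word
forgetBars t = (proj₁ t , map proj₁ (proj₂ t))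

π-++ : ∀ p q → π (p ++ q) ≡ π p ++ π q
π-++ p q = LP.map-++ forgetBars p q

π-· : ∀ c p → π (c MRP.· p) ≡ c SymP.· π p
π-· c p = trans (sym (LP.map-∘ p)) (LP.map-∘ p)

π-⊗ : ∀ p q → π (p MRP.⊗ q) ≡ π p SymP.⊗ π q
π-⊗ [] q = refl
π-⊗ (s ∷ p) q = begin
    π (leftMulM ++ (p MRP.⊗ q))
  ≡⟨ π-++ leftMulM (p MRP.⊗ q) ⟩
    π leftMulM ++ π (p MRP.⊗ q)
  ≡⟨ cong₂ _++_ (trans (sym (LP.map-∘ q))
                   (trans (LP.map-cong (λ t → cong (proj₁ s Q.* proj₁ t ,_) (LP.map-++ proj₁ (proj₂ s) (proj₂ t))) q)
                          (LP.map-∘ q)))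
                (π-⊗ p q) ⟩
    leftMul (proj₁ s) (map proj₁ (proj₂ s)) (π q) ++ (π p SymP.⊗ π q)
  ∎
  where
  open ≡-Reasoning
  leftMulM = map (λ t → (proj₁ s Q.* proj₁ t , proj₂ s ++ proj₂ t)) q

π-sumP : ∀ ps → π (MRP.sumP ps) ≡ SymP.sumP (map π ps)
π-sumP [] = refl
π-sumP (p ∷ ps) = trans (π-++ p (MRP.sumP ps)) (cong (π p ++_) (π-sumP ps))

π-prodP : ∀ ps → π (MRP.prodP ps) ≡ SymP.prodP (map π ps)
π-prodP [] = refl
π-prodP (p ∷ ps) = trans (π-⊗ p (MRP.prodP ps)) (cong (π p SymP.⊗_) (π-prodP ps))

π-powP : ∀ p m → π (MRP.powP p m) ≡ SymP.powP (π p) m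
π-powP p zero = refl
π-powP p (suc m) = trans (π-⊗ p (MRP.powP p m)) (cong (π p SymP.⊗_) (π-powP p m))

π-map : ∀ {X : Set} (F : X → MRPol) (G : X → SymPol) → (∀ x → π (F x) ≡ G x) → ∀ L → map π (map F L) ≡ map G L
π-map F G e L = trans (sym (LP.map-∘ {g = π} {f = F} L)) (LP.map-cong e L)

π-expT : ∀ N p → π (MRP.expT N p) ≡ SymP.expT N (π p)
π-expT N p = trans (π-sumP (map (λ m → invFact m MRP.· MRP.powP p m) (upTo (suc N))))
  (cong SymP.sumP (π-map (λ m → invFact m MRP.· MRP.powP p m) (λ m → invFact m SymP.· SymP.powP (π p) m)
    (λ m → trans (π-· (invFact m) (MRP.powP p m)) (cong (invFact m SymP.·_) (π-powP p m))) (upTo (suc N))))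

π-exps : ∀ (ζ : ℕ → MRPol) N → map π (map (λ k → MRP.expT N (ζ k)) (oneTo N)) ≡ map (λ k → SymP.expT N (π (ζ k))) (oneTo N)
π-exps ζ N = π-map (λ k → MRP.expT N (ζ k)) (λ k → SymP.expT N (π (ζ k))) (λ k → π-expT N (ζ k)) (oneTo N)

π-expsUp : ∀ (ζ : ℕ → MRPol) N → π (expsUp ζ N) ≡ SymP.prodP (map (λ k → SymP.expT N (π (ζ k))) (oneTo N))
π-expsUp ζ N = trans (π-prodP (map (λ k → MRP.expT N (ζ k)) (oneTo N))) (cong SymP.prodP (π-exps ζ N))

π-expsDown : ∀ (ζ : ℕ → MRPol) N → π (expsDown ζ N) ≡ SymP.prodP (reverse (map (λ k → SymP.expT N (π (ζ k))) (oneTo N)))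
π-expsDown ζ N = trans (π-prodP (reverse (map (λ k → MRP.expT N (ζ k)) (oneTo N))))
  (cong SymP.prodP (trans (LP.reverse-map π (map (λ k → MRP.expT N (ζ k)) (oneTo N))) (cong reverse (π-exps ζ N))))

π-SM : ∀ k → π (SM k) ≡ S k
π-SM zero = refl
π-SM (suc k) = refl

π-ΛRev : ∀ n → map π (ΛRev n) ≡ ΛRevS n
π-ΛRev zero = refl
π-ΛRev (suc n) = cong₂ _∷_ (begin
    π (MRP.neg (MRP.sumP (L.zipWith termM (oneTo (suc n)) (ΛRev n))))
  ≡⟨ π-· (Q.- 1ℚ) (MRP.sumP (L.zipWith termM (oneTo (suc n)) (ΛRev n))) ⟩
    SymP.neg (π (MRP.sumP (L.zipWith termM (oneTo (suc n)) (ΛRev n))))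
  ≡⟨ cong SymP.neg (π-sumP (L.zipWith termM (oneTo (suc n)) (ΛRev n))) ⟩
    SymP.neg (SymP.sumP (map π (L.zipWith termM (oneTo (suc n)) (ΛRev n))))
  ≡⟨ cong (SymP.neg ∘ SymP.sumP) (π-terms (oneTo (suc n)) (ΛRev n)) ⟩
    SymP.neg (SymP.sumP (L.zipWith ΛTerm (oneTo (suc n)) (map π (ΛRev n))))
  ≡⟨ cong (λ ls → SymP.neg (SymP.sumP (L.zipWith ΛTerm (oneTo (suc n)) ls))) (π-ΛRev n) ⟩
    SymP.neg (SymP.sumP (L.zipWith ΛTerm (oneTo (suc n)) (ΛRevS n)))
  ∎) (π-ΛRev n)
  where
  open ≡-Reasoning
  termM : ℕ → MRPol → MRPol
  termM k Λ = sgn k MRP.· (SM k MRP.⊗ Λ)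
  π-terms : ∀ ks ls → map π (L.zipWith termM ks ls) ≡ L.zipWith ΛTerm ks (map π ls)
  π-terms [] ls = refl
  π-terms (k ∷ ks) [] = refl
  π-terms (k ∷ ks) (l ∷ ls) = cong₂ _∷_
    (trans (π-· (sgn k) (SM k MRP.⊗ l)) (cong (sgn k SymP.·_) (trans (π-⊗ (SM k) l) (cong (SymP._⊗ π l) (π-SM k)))))
    (π-terms ks ls)

π-ΛM : ∀ n → π (ΛM n) ≡ ΛS n
π-ΛM n = trans (π-head (ΛRev n)) (cong (headOr SymP.zeroP) (π-ΛRev n))
  where
  π-head : ∀ (ls : List MRPol) → π (headOr MRP.zeroP ls) ≡ headOr SymP.zeroP (map π ls)
  π-head [] = refl
  π-head (l ∷ ls) = refl

-- bar is an anti-automorphism, so after forgetting bars it reverses words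
π-barP : ∀ p → π (barP p) ≡ revP (π p)
π-barP p = trans (sym (LP.map-∘ p)) (trans (LP.map-cong (λ t → cong (proj₁ t ,_)
   (trans (LP.reverse-map proj₁ (map (λ a → (proj₁ a , not (proj₂ a))) (proj₂ t)))
     (cong reverse (sym (LP.map-∘ (proj₂ t)))))) p) (LP.map-∘ p))

π-σ₁M : ∀ N → π (σ₁M N) ≡ σ₁ N
π-σ₁M N = trans (π-sumP (map SM (upTo (suc N)))) (cong SymP.sumP (π-map SM S π-SM (upTo (suc N))))

π-σ₁♯ : ∀ N → π (σ₁♯ N) ≡ SymP.sumP (map (λ n → revP (ΛS n)) (upTo (suc N))) SymP.⊗ σ₁ N
π-σ₁♯ N = trans (π-⊗ (MRP.sumP (map Λbar (upTo (suc N)))) (σ₁M N))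
  (cong₂ SymP._⊗_
    (trans (π-sumP (map Λbar (upTo (suc N))))
      (cong SymP.sumP (π-map Λbar (λ n → revP (ΛS n)) (λ n → trans (π-barP (ΛM n)) (cong revP (π-ΛM n))) (upTo (suc N)))))
    (π-σ₁M N))

open MRCoefficients using () renaming (mono to monoM; coeff-cons to coeffM-cons)

cfM : MRPol → MWord → ℚ
cfM = MRP.coeff

sumℚ : List ℚ → ℚ
sumℚ = foldr Q._+_ 0ℚ

lifts : Word → List MWord
lifts [] = [] ∷ []
lifts (a ∷ w) = map ((a , false) ∷_) (lifts w) ++ map ((a , true) ∷_) (lifts w)

sumℚ-++ : ∀ xs ys → sumℚ (xs ++ ys) ≡ sumℚ xs Q.+ sumℚ ys
sumℚ-++ [] ys = sym (QP.+-identityˡ _)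
sumℚ-++ (x ∷ xs) ys = trans (cong (x Q.+_) (sumℚ-++ xs ys)) (sym (QP.+-assoc x (sumℚ xs) (sumℚ ys)))

sumℚ-+ : ∀ {X : Set} (f g : X → ℚ) L → sumℚ (map (λ x → f x Q.+ g x) L) ≡ sumℚ (map f L) Q.+ sumℚ (map g L)
sumℚ-+ f g [] = sym (QP.+-identityˡ 0ℚ)
sumℚ-+ f g (x ∷ L) = trans (cong (f x Q.+ g x Q.+_) (sumℚ-+ f g L)) (+-interchange (f x) (g x) (sumℚ (map f L)) (sumℚ (map g L)))

sumℚ-cong : ∀ {X : Set} (f g : X → ℚ) L → All (λ x → f x ≡ g x) L → sumℚ (map f L) ≡ sumℚ (map g L)
sumℚ-cong f g [] [] = refl
sumℚ-cong f g (x ∷ L) (e ∷ es) = cong₂ Q._+_ e (sumℚ-cong f g L es)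

sumℚ-vanishing : ∀ {X : Set} (f : X → ℚ) L → All (λ x → f x ≡ 0ℚ) L → sumℚ (map f L) ≡ 0ℚ
sumℚ-vanishing f [] [] = refl
sumℚ-vanishing f (x ∷ L) (e ∷ es) = trans (cong₂ Q._+_ e (sumℚ-vanishing f L es)) (QP.+-identityˡ 0ℚ)

sumℚ-when : ∀ {X : Set} b (f : X → ℚ) L → sumℚ (map (λ x → when b (f x)) L) ≡ when b (sumℚ (map f L))
sumℚ-when true f L = refl
sumℚ-when false f L = sumℚ-vanishing (λ _ → 0ℚ) L (All.universal (λ _ → refl) L)

sumℚ-lifts-with : ∀ (f : MWord → ℚ) a b w → sumℚ (map f (map ((a , b) ∷_) (lifts w))) ≡ sumℚ (map (f ∘ ((a , b) ∷_)) (lifts w))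
sumℚ-lifts-with f a b w = cong sumℚ (sym (LP.map-∘ (lifts w)))

sumℚ-lifts-∷ : ∀ (f : MWord → ℚ) a w →
  sumℚ (map f (lifts (a ∷ w))) ≡ sumℚ (map (f ∘ ((a , false) ∷_)) (lifts w)) Q.+ sumℚ (map (f ∘ ((a , true) ∷_)) (lifts w))
sumℚ-lifts-∷ f a w = trans (cong sumℚ (LP.map-++ f (map ((a , false) ∷_) (lifts w)) (map ((a , true) ∷_) (lifts w))))
  (trans (sumℚ-++ (map f (map ((a , false) ∷_) (lifts w))) (map f (map ((a , true) ∷_) (lifts w))))
    (cong₂ Q._+_ (sumℚ-lifts-with f a false w) (sumℚ-lifts-with f a true w)))

monoM-∷ : ∀ c a' b' u a b v → monoM c ((a' , b') ∷ u) ((a , b) ∷ v) ≡ when (does (a' ℕ.≟ a) ∧ does (b' BoolP.≟ b)) (monoM c u v)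
monoM-∷ c a' b' u a b v rewrite does-⇔ ((a' , b') ≟MR (a , b)) ((a' ℕ.≟ a) ×-dec (b' BoolP.≟ b))
                                    (λ { refl → refl , refl }) (λ { (refl , refl) → refl })
  with does (a' ℕ.≟ a) ∧ does (b' BoolP.≟ b)
... | true = refl
... | false = refl

mono-∷ : ∀ c a' u a w → mono c (a' ∷ u) (a ∷ w) ≡ when (does (a' ℕ.≟ a)) (mono c u w)
mono-∷ c a' u a w with does (a' ℕ.≟ a)
... | true = refl
... | false = refl

-- Exactly one lift of w is the word u, if u lies over w at all.
sumℚ-lifts-mono : ∀ c u w → sumℚ (map (monoM c u) (lifts w)) ≡ mono c (map proj₁ u) w
sumℚ-lifts-mono c [] [] = QP.+-identityʳ c
sumℚ-lifts-mono c (x ∷ u) [] = QP.+-identityʳ 0ℚ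
sumℚ-lifts-mono c [] (a ∷ w) = trans (sumℚ-lifts-∷ (monoM c []) a w)
  (trans (cong₂ Q._+_ (sumℚ-vanishing _ (lifts w) (All.universal (λ _ → refl) (lifts w)))
                      (sumℚ-vanishing _ (lifts w) (All.universal (λ _ → refl) (lifts w))))
         (QP.+-identityˡ 0ℚ))
sumℚ-lifts-mono c ((a' , b') ∷ u) (a ∷ w) = begin
    sumℚ (map (monoM c ((a' , b') ∷ u)) (lifts (a ∷ w)))
  ≡⟨ sumℚ-lifts-∷ (monoM c ((a' , b') ∷ u)) a w ⟩
    sumℚ (map (monoM c ((a' , b') ∷ u) ∘ ((a , false) ∷_)) (lifts w)) Q.+ sumℚ (map (monoM c ((a' , b') ∷ u) ∘ ((a , true) ∷_)) (lifts w))
  ≡⟨ cong₂ Q._+_ (barred false) (barred true) ⟩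
    when (does (a' ℕ.≟ a) ∧ does (b' BoolP.≟ false)) X Q.+ when (does (a' ℕ.≟ a) ∧ does (b' BoolP.≟ true)) X
  ≡⟨ one-of b' (does (a' ℕ.≟ a)) ⟩
    when (does (a' ℕ.≟ a)) X
  ≡⟨ cong (when (does (a' ℕ.≟ a))) (sumℚ-lifts-mono c u w) ⟩
    when (does (a' ℕ.≟ a)) (mono c (map proj₁ u) w)
  ≡⟨ sym (mono-∷ c a' (map proj₁ u) a w) ⟩
    mono c (a' ∷ map proj₁ u) (a ∷ w)
  ∎
  where
  open ≡-Reasoning
  X = sumℚ (map (monoM c u) (lifts w))
  barred : ∀ b → sumℚ (map (monoM c ((a' , b') ∷ u) ∘ ((a , b) ∷_)) (lifts w)) ≡ when (does (a' ℕ.≟ a) ∧ does (b' BoolP.≟ b)) X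
  barred b = trans (sumℚ-cong _ (λ v → when (does (a' ℕ.≟ a) ∧ does (b' BoolP.≟ b)) (monoM c u v)) (lifts w)
                      (All.universal (monoM-∷ c a' b' u a b) (lifts w)))
                   (sumℚ-when (does (a' ℕ.≟ a) ∧ does (b' BoolP.≟ b)) (monoM c u) (lifts w))
  one-of : ∀ b' d → when (d ∧ does (b' BoolP.≟ false)) X Q.+ when (d ∧ does (b' BoolP.≟ true)) X ≡ when d X
  one-of false true = QP.+-identityʳ X
  one-of true true = QP.+-identityˡ X
  one-of false false = QP.+-identityˡ 0ℚ
  one-of true false = QP.+-identityˡ 0ℚ

cf-π : ∀ p w → cf (π p) w ≡ sumℚ (map (cfM p) (lifts w))
cf-π [] w = sym (sumℚ-vanishing (λ _ → 0ℚ) (lifts w) (All.universal (λ _ → refl) (lifts w)))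
cf-π ((c , u) ∷ p) w = begin
    cf ((c , map proj₁ u) ∷ π p) w                                   ≡⟨ coeff-cons c (map proj₁ u) (π p) w ⟩
    mono c (map proj₁ u) w Q.+ cf (π p) w                            ≡⟨ cong₂ Q._+_ (sym (sumℚ-lifts-mono c u w)) (cf-π p w) ⟩
    sumℚ (map (monoM c u) (lifts w)) Q.+ sumℚ (map (cfM p) (lifts w)) ≡⟨ sym (sumℚ-+ (monoM c u) (cfM p) (lifts w)) ⟩
    sumℚ (map (λ v → monoM c u v Q.+ cfM p v) (lifts w))             ≡⟨ sumℚ-cong _ (cfM ((c , u) ∷ p)) (lifts w)
                                                                          (All.universal (λ v → sym (coeffM-cons c u p v)) (lifts w)) ⟩
    sumℚ (map (cfM ((c , u) ∷ p)) (lifts w))                         ∎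
  where open ≡-Reasoning

lifts-deg : ∀ w → All (λ v → MRP.deg v ≡ dg w) (lifts w)
lifts-deg [] = refl ∷ []
lifts-deg (a ∷ w) = AllP.++⁺ (AllP.map⁺ (All.map (cong (suc a ℕ.+_)) (lifts-deg w)))
                             (AllP.map⁺ (All.map (cong (suc a ℕ.+_)) (lifts-deg w)))

π-agree : ∀ N p q → p MRP.≈[ N ] q → Agree N (cf (π p)) (cf (π q))
π-agree N p q h w le = trans (cf-π p w) (trans (sumℚ-cong (cfM p) (cfM q) (lifts w)
    (All.map (λ {v} e → MRCoefficients.≈[]-coeff N p q h v (subst (_≤ N) (sym e) le)) (lifts-deg w)))
  (sym (cf-π q w)))

π-homogeneous : ∀ k p → MRP.Homogeneous k p → ∀ w → dg w ≢ k → cf (π p) w ≡ 0ℚ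
π-homogeneous k p h w ne = trans (cf-π p w) (sumℚ-vanishing (cfM p) (lifts w)
  (All.map (λ {v} e → MRCoefficients.homogeneous-coeff k p h v (λ e' → ne (trans (sym e) e'))) (lifts-deg w)))

cf-π-⊗ : ∀ p q → cf (π (p MRP.⊗ q)) ≗ conv (cf (π p)) (cf (π q))
cf-π-⊗ p q w = trans (cong (λ r → cf r w) (π-⊗ p q)) (cf-⊗ (π p) (π q) w)

cf-π-expsUp : ∀ (ζ : ℕ → MRPol) N → cf (π (expsUp ζ N)) ≗ expsUpS (λ k → cf (π (ζ k))) N
cf-π-expsUp ζ N w = trans (cong (λ p → cf p w) (π-expsUp ζ N))
  (cf-prodP-map (λ k → SymP.expT N (π (ζ k))) (λ k → sexp N (cf (π (ζ k)))) (λ k → cf-expT N (π (ζ k))) (oneTo N) w)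

cf-π-expsDown : ∀ (ζ : ℕ → MRPol) N → cf (π (expsDown ζ N)) ≗ expsDownS (λ k → cf (π (ζ k))) N
cf-π-expsDown ζ N w = trans (cong (λ p → cf p w) (π-expsDown ζ N))
  (cf-prodP-reverse-map (λ k → SymP.expT N (π (ζ k))) (λ k → sexp N (cf (π (ζ k)))) (λ k → cf-expT N (π (ζ k))) (oneTo N) w)

All-filter : ∀ (b : ℕ → Bool) v L → All (λ k → b k ≡ v) (filter (λ k → b k BoolP.≟ v) L)
All-filter b v [] = []
All-filter b v (k ∷ L) with b k BoolP.≟ v
... | yes e = e ∷ All-filter b v L
... | no _ = All-filter b v L

module _ (b : ℕ → Bool) (F G : ℕ → Ser) (trivial : ∀ k → b k ≡ true → F k ≗ δ) (other : ∀ k → b k ≡ false → F k ≗ G k) where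

  private
    rest : List ℕ → List ℕ
    rest = filter (λ k → b k BoolP.≟ false)

  sprod-filter : ∀ L → sprod (map F L) ≗ sprod (map G (rest L))
  sprod-filter [] w = refl
  sprod-filter (k ∷ L) w with b k in e
  ... | true = trans (conv-cong (trivial k e) (λ _ → refl) w) (trans (conv-identityˡ _ w) (sprod-filter L w))
  ... | false = conv-cong (other k e) (sprod-filter L) w

  sprod-reverse-filter : ∀ L → sprod (reverse (map F L)) ≗ sprod (reverse (map G (rest L)))
  sprod-reverse-filter [] w = refl
  sprod-reverse-filter (k ∷ L) w with b k in e
  ... | true = trans (sprod-reverse-∷ (F k) (map F L) w)
                (trans (conv-cong (λ _ → refl) (trivial k e) w) (trans (conv-identityʳ _ w) (sprod-reverse-filter L w)))
  ... | false = trans (sprod-reverse-∷ (F k) (map F L) w)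
                 (trans (conv-cong (sprod-reverse-filter L) (other k e) w) (sym (sprod-reverse-∷ (G k) (map G (rest L)) w)))

ssum-filter : ∀ (P : ℕ → Bool) (F : ℕ → Ser) w L →
  ssum (map F (filter (λ k → P k BoolP.≟ true) L)) w ≡ ssum (map (λ k w' → when (P k) (F k w')) L) w
ssum-filter P F w [] = refl
ssum-filter P F w (k ∷ L) with P k
... | true = cong (F k w Q.+_) (ssum-filter P F w L)
... | false = trans (ssum-filter P F w L) (sym (QP.+-identityˡ _))

sexp-zero : ∀ N → sexp N zS ≗ δ
sexp-zero N w = sexp-tail-vanishing N zS w (λ j → conv-zeroˡ (spow zS j) w)

telescope : ∀ N (E⁻ E : ℕ → Ser) L → All (λ k → Agree N (conv (E⁻ k) (E k)) δ) L →
  Agree N (conv (sprod (reverse (map E⁻ L))) (sprod (map E L))) δ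
telescope N E⁻ E [] [] w le = conv-identityˡ δ w
telescope N E⁻ E (k ∷ L) (h ∷ hs) = Agree-trans (≗⇒Agree regroup)
   (Agree-trans (conv-agree N Agree-refl (Agree-trans (conv-agree N h Agree-refl) (≗⇒Agree (conv-identityˡ Up))))
      (telescope N E⁻ E L hs))
  where
  Down⁻ = sprod (reverse (map E⁻ L))
  Up = sprod (map E L)
  regroup : conv (sprod (reverse (map E⁻ (k ∷ L)))) (sprod (map E (k ∷ L))) ≗ conv Down⁻ (conv (conv (E⁻ k) (E k)) Up)
  regroup w = begin
      conv (sprod (reverse (E⁻ k ∷ map E⁻ L))) (conv (E k) Up) w   ≡⟨ conv-cong (sprod-reverse-∷ (E⁻ k) (map E⁻ L)) (λ _ → refl) w ⟩
      conv (conv Down⁻ (E⁻ k)) (conv (E k) Up) w                    ≡⟨ conv-assoc Down⁻ (E⁻ k) (conv (E k) Up) w ⟩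
      conv Down⁻ (conv (E⁻ k) (conv (E k) Up)) w                    ≡⟨ conv-cong (λ _ → refl) (λ w' → sym (conv-assoc (E⁻ k) (E k) Up w')) w ⟩
      conv Down⁻ (conv (conv (E⁻ k) (E k)) Up) w                    ∎
    where open ≡-Reasoning

-- The specialisation of ζ, ζ̃ and e_I

module Specialisation (ζ ζ̃ : ℕ → MRPol) (z : ℕ → SymPol)
                      (hζ : IsZeta ζ) (hζ̃ : IsZetaTilde ζ ζ̃) (hz : IsZeta2 z) where

  -- π(ζ_k) and ζ⁽²⁾_k as series, and the claimed value W_k of π(ζ_k)
  u zs W : ℕ → Ser
  u k = cf (π (ζ k))
  zs k = cf (z k)
  W k = if isEven k then zS else zs k

  W-even : ∀ k → isEven k ≡ true → W k ≗ zS
  W-even k e w = cong (λ b → (if b then zS else zs k) w) e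

  W-odd : ∀ k → isEven k ≡ false → W k ≗ zs k
  W-odd k e w = cong (λ b → (if b then zS else zs k) w) e

  zs-homogeneous : ∀ k w → dg w ≢ k → zs k w ≡ 0ℚ
  zs-homogeneous k = homogeneous-coeff k (z k) (proj₁ (proj₂ hz) k)

  u-family : HomogeneousFamily u
  u-family k = π-homogeneous (suc k) (ζ (suc k)) (proj₁ hζ k)

  W-family : HomogeneousFamily W
  W-family k w ne with isEven (suc k) in e
  ... | true = refl
  ... | false = zs-homogeneous (suc k) w ne

  zs-odd-van : ∀ k → isEven k ≡ false → Van 1 (zs k)
  zs-odd-van k e w lt rewrite dg≤0⇒[] w (NP.≤-pred lt) = zs-homogeneous k [] (λ { refl → case e })
    where
    case : true ≡ false → ⊥
    case ()

  πσ₁♯-factorisation : ∀ N → Agree N (conv (revΛsum N) (cf (σ₁ N))) (conv (expsUpS u N) (expsDownS u N))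
  πσ₁♯-factorisation N = Agree-trans (≗⇒Agree image-σ₁♯)
    (Agree-trans (π-agree N (σ₁♯ N) (expsUp ζ N MRP.⊗ expsDown ζ N) (proj₂ hζ N))
      (≗⇒Agree (λ w → trans (cf-π-⊗ (expsUp ζ N) (expsDown ζ N) w) (conv-cong (cf-π-expsUp ζ N) (cf-π-expsDown ζ N) w))))
    where
    image-σ₁♯ : conv (revΛsum N) (cf (σ₁ N)) ≗ cf (π (σ₁♯ N))
    image-σ₁♯ w = sym (trans (cong (λ p → cf p w) (π-σ₁♯ N))
      (trans (cf-⊗ (SymP.sumP (map (λ n → revP (ΛS n)) (upTo (suc N)))) (σ₁ N) w)
        (conv-cong (cf-sumP-map (λ n → revP (ΛS n)) (λ n → cf (revP (ΛS n))) (λ _ _ → refl) (upTo (suc N))) (λ _ → refl) w)))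

  -- Step 2: from σ₁ = Z·Down (the definition of ζ⁽²⁾), the same series θ(σ₁)⁻¹σ₁ equals Up·Down,
  -- the symmetric factorisation with exponents W_k.
  module EvenOdd (N : ℕ) where
    odds = filter (λ k → isEven k BoolP.≟ false) (oneTo N)
    evens = filter (λ k → isEven k BoolP.≟ true) (upTo (suc N))
    E E⁻ : ℕ → Ser
    E k = sexp N (zs k)
    E⁻ k = sexp N (θ (zs k))
    σ = cf (σ₁ N)
    Z = ssum (map zs evens)
    Up = sprod (map E odds)
    Down = sprod (reverse (map E odds))
    Down⁻ = sprod (reverse (map E⁻ odds))

    odds-odd : All (λ k → isEven k ≡ false) odds
    odds-odd = All-filter isEven false (oneTo N)

    σ≈Z·Down : Agree N σ (conv Z Down)
    σ≈Z·Down = Agree-trans (≈[]⇒Agree N (σ₁ N) (SymP.sumP (map z evens) SymP.⊗ D) (proj₂ (proj₂ hz) N))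
      (≗⇒Agree (λ w → trans (cf-⊗ (SymP.sumP (map z evens)) D w)
         (conv-cong (cf-sumP-map z zs (λ _ _ → refl) evens) (cf-prodP-reverse-map (λ k → SymP.expT N (z k)) E (λ k → cf-expT N (z k)) odds) w)))
      where
      D = SymP.prodP (reverse (map (λ k → SymP.expT N (z k)) odds))

    θZ≗Z : θ Z ≗ Z
    θZ≗Z w = trans (θ-ssum (map zs evens) w) (trans (cong (λ q → ssum q w) (sym (LP.map-∘ {g = θ} {f = zs} evens)))
      (ssum-map-cong (θ ∘ zs) zs evens (All.map (λ {k} e w' → trans (θ-homogeneous k (zs k) (zs-homogeneous k) w')
                                                                 (trans (cong (Q._* zs k w') (sgn-even k e)) (QP.*-identityˡ _)))
                                          (All-filter isEven true (upTo (suc N)))) w))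

    θDown≗Down⁻ : θ Down ≗ Down⁻
    θDown≗Down⁻ w = trans (θ-sprod (reverse (map E odds)) w)
      (trans (cong (λ q → sprod q w) (trans (LP.reverse-map θ (map E odds)) (cong reverse (sym (LP.map-∘ {g = θ} {f = E} odds)))))
        (sprod-reverse-map-cong (θ ∘ E) E⁻ odds (All.universal (λ k → θ-sexp N (zs k)) odds) w))

    θσ≈Z·Down⁻ : Agree N (θ σ) (conv Z Down⁻)
    θσ≈Z·Down⁻ = Agree-trans (θ-agree σ≈Z·Down) (≗⇒Agree (λ w → trans (θ-conv Z Down w) (conv-cong θZ≗Z θDown≗Down⁻ w)))

    Down⁻·Up≈1 : Agree N (conv Down⁻ Up) δ
    Down⁻·Up≈1 = telescope N E⁻ E odds (All.map (λ {k} e → Agree-trans (conv-agree N (≗⇒Agree (E⁻-neg k e)) Agree-refl)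
                                                                       (sexp-neg-inverse N (zs k) (zs-odd-van k e))) odds-odd)
      where
      E⁻-neg : ∀ k → isEven k ≡ false → E⁻ k ≗ sexp N (negS (zs k))
      E⁻-neg k e = sexp-cong N (λ w → trans (θ-homogeneous k (zs k) (zs-homogeneous k) w) (cong (Q._* zs k w) (sgn-odd k e)))

    Z≈θσ·Up : Agree N Z (conv (θ σ) Up)
    Z≈θσ·Up = Agree-trans (≗⇒Agree (λ w → sym (conv-identityʳ Z w)))
      (Agree-trans (conv-agree N Agree-refl (Agree-sym Down⁻·Up≈1))
        (Agree-trans (≗⇒Agree (λ w → sym (conv-assoc Z Down⁻ Up w))) (conv-agree N (Agree-sym θσ≈Z·Down⁻) Agree-refl)))

    -- θ(σ₁)⁻¹ σ₁ = θ(σ₁)⁻¹ Z Down = θ(σ₁)⁻¹ θ(σ₁) Up Down = Up Down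
    revΛσ≈Up·Down : Agree N (conv (revΛsum N) σ) (conv Up Down)
    revΛσ≈Up·Down = Agree-trans (conv-agree N Agree-refl σ≈Z·Down)
      (Agree-trans (conv-agree N Agree-refl (conv-agree N Z≈θσ·Up Agree-refl))
        (Agree-trans (≗⇒Agree (λ w → trans (conv-cong (λ _ → refl) (conv-assoc (θ σ) Up Down) w)
                                           (sym (conv-assoc (revΛsum N) (θ σ) (conv Up Down) w))))
          (Agree-trans (conv-agree N (revΛsum-inverse-θσ₁ N) Agree-refl) (≗⇒Agree (conv-identityˡ (conv Up Down))))))

    trivial-even : ∀ k → isEven k ≡ true → sexp N (W k) ≗ δ
    trivial-even k e w = trans (sexp-cong N (W-even k e) w) (sexp-zero N w)

    odd-exponent : ∀ k → isEven k ≡ false → sexp N (W k) ≗ E k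
    odd-exponent k e = sexp-cong N (W-odd k e)

    expsUpS-W : expsUpS W N ≗ Up
    expsUpS-W = sprod-filter isEven (λ k → sexp N (W k)) E trivial-even odd-exponent (oneTo N)

    expsDownS-W : expsDownS W N ≗ Down
    expsDownS-W = sprod-reverse-filter isEven (λ k → sexp N (W k)) E trivial-even odd-exponent (oneTo N)

    W-factorisation : Agree N (conv (revΛsum N) σ) (conv (expsUpS W N) (expsDownS W N))
    W-factorisation = Agree-trans revΛσ≈Up·Down (≗⇒Agree (λ w → sym (conv-cong expsUpS-W expsDownS-W w)))

    Down-constant : Down [] ≡ 1ℚ
    Down-constant = sprod-reverse-constant (map E odds)
      (AllP.map⁺ (All.map (λ {k} e → sexp-constant N (zs k) (zs-odd-van k e)) odds-odd))

  π-ζ≗W : ∀ n → u (suc n) ≗ W (suc n)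
  π-ζ≗W = factorisation-unique u W u-family W-family
    (λ N → Agree-trans (Agree-sym (πσ₁♯-factorisation N)) (EvenOdd.W-factorisation N))

  π-ζ : (n : ℕ) → π (ζ (suc n)) SymP.≈ (if isEven (suc n) then SymP.zeroP else z (suc n))
  π-ζ n w = trans (π-ζ≗W n w) (by-parity (isEven (suc n)) refl)
    where
    by-parity : ∀ b → isEven (suc n) ≡ b → W (suc n) w ≡ cf (if b then SymP.zeroP else z (suc n)) w
    by-parity true e = W-even (suc n) e w
    by-parity false e = W-odd (suc n) e w

  -- Step 4: σ₁ = π(Σ ζ̃_k)·Down = Z·Down, and Down is cancellable, so Σ π(ζ̃_k) = Z.
  t : ℕ → Ser
  t k = cf (π (ζ̃ k))

  T : ℕ → Ser
  T N = ssum (map t (upTo (suc N)))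

  expsDownS-u≗W : ∀ N → expsDownS u N ≗ expsDownS W N
  expsDownS-u≗W N w = begin
      sprod (reverse (map (λ k → sexp N (u k)) (oneTo N))) w
    ≡⟨ cong (λ q → sprod (reverse q) w) (oneTo-map (λ k → sexp N (u k)) N) ⟩
      sprod (reverse (map (λ j → sexp N (u (suc j))) (upTo N))) w
    ≡⟨ sprod-reverse-map-cong (λ j → sexp N (u (suc j))) (λ j → sexp N (W (suc j))) (upTo N)
         (All.universal (λ j → sexp-cong N (π-ζ≗W j)) (upTo N)) w ⟩
      sprod (reverse (map (λ j → sexp N (W (suc j))) (upTo N))) w
    ≡⟨ cong (λ q → sprod (reverse q) w) (sym (oneTo-map (λ k → sexp N (W k)) N)) ⟩
      sprod (reverse (map (λ k → sexp N (W k)) (oneTo N))) w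
    ∎
    where open ≡-Reasoning

  σ≈T·Down : ∀ N → Agree N (cf (σ₁ N)) (conv (T N) (EvenOdd.Down N))
  σ≈T·Down N = Agree-trans (≗⇒Agree (λ w → cong (λ p → cf p w) (sym (π-σ₁M N))))
    (Agree-trans (π-agree N (σ₁M N) (MRP.sumP (map ζ̃ (upTo (suc N))) MRP.⊗ expsDown ζ N) (proj₂ (proj₂ hζ̃) N))
      (≗⇒Agree (λ w → trans (cf-π-⊗ (MRP.sumP (map ζ̃ (upTo (suc N)))) (expsDown ζ N) w)
        (conv-cong image-sum (λ w' → trans (cf-π-expsDown ζ N w') (trans (expsDownS-u≗W N w') (EvenOdd.expsDownS-W N w'))) w))))
    where
    image-sum : cf (π (MRP.sumP (map ζ̃ (upTo (suc N))))) ≗ T N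
    image-sum w = trans (cong (λ p → cf p w) (trans (π-sumP (map ζ̃ (upTo (suc N))))
                                                    (cong SymP.sumP (π-map ζ̃ (π ∘ ζ̃) (λ _ → refl) (upTo (suc N))))))
                        (cf-sumP-map (π ∘ ζ̃) t (λ _ _ → refl) (upTo (suc N)) w)

  T≈Z : ∀ N → Agree N (T N) (EvenOdd.Z N)
  T≈Z N = cancelʳ N (EvenOdd.Down-constant N) (Agree-trans (Agree-sym (σ≈T·Down N)) (EvenOdd.σ≈Z·Down N))

  π-ζ̃-series : ∀ n → t n ≗ (if isEven n then zs n else zS)
  π-ζ̃-series n w with dg w ℕ.≟ n
  ... | no ne = trans (t-homogeneous n w ne) (masked (isEven n))
    where
    masked : ∀ b → 0ℚ ≡ (if b then zs n else zS) w
    masked true = sym (zs-homogeneous n w ne)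
    masked false = refl
    t-homogeneous : ∀ k w → dg w ≢ k → t k w ≡ 0ℚ
    t-homogeneous k = π-homogeneous k (ζ̃ k) (proj₁ (proj₂ hζ̃) k)
  ... | yes refl = begin
        t n w
      ≡⟨ sym (when-yes (n ℕ.<? suc n) NP.≤-refl (t n w)) ⟩
        when (does (n ℕ.<? suc n)) (t n w)
      ≡⟨ sym (ssum-single t w n (λ j ne → π-homogeneous j (ζ̃ j) (proj₁ (proj₂ hζ̃) j) w (λ e → ne (sym e))) (suc n)) ⟩
        T n w
      ≡⟨ T≈Z n w NP.≤-refl ⟩
        EvenOdd.Z n w
      ≡⟨ ssum-filter isEven zs w (upTo (suc n)) ⟩
        ssum (map (λ k w' → when (isEven k) (zs k w')) (upTo (suc n))) w
      ≡⟨ ssum-single (λ k w' → when (isEven k) (zs k w')) w n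
           (λ j ne → trans (cong (when (isEven j)) (zs-homogeneous j w (λ e → ne (sym e)))) (when-0 (isEven j))) (suc n) ⟩
        when (does (n ℕ.<? suc n)) (when (isEven n) (zs n w))
      ≡⟨ when-yes (n ℕ.<? suc n) NP.≤-refl _ ⟩
        when (isEven n) (zs n w)
      ≡⟨ masked (isEven n) ⟩
        (if isEven n then zs n else zS) w
      ∎
    where
    open ≡-Reasoning
    masked : ∀ b → when b (zs n w) ≡ (if b then zs n else zS) w
    masked true = refl
    masked false = refl

  π-ζ̃ : (n : ℕ) → π (ζ̃ n) SymP.≈ (if isEven n then z n else SymP.zeroP)
  π-ζ̃ n w = trans (π-ζ̃-series n w) (by-parity (isEven n))
    where
    by-parity : ∀ b → (if b then zs n else zS) w ≡ cf (if b then z n else SymP.zeroP) w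
    by-parity true = refl
    by-parity false = refl

  π-prod-ζ : ∀ is → All (λ i → 1 ℕ.≤ i) is →
    sprod (map u is) ≗ (if and (map (λ i → not (isEven i)) is) then sprod (map zs is) else zS)
  π-prod-ζ [] [] w = refl
  π-prod-ζ (suc j ∷ is) (s≤s _ ∷ hs) w =
    trans (conv-cong (π-ζ≗W j) (π-prod-ζ is hs) w) (by-parity (isEven (suc j)) refl (and (map (λ i → not (isEven i)) is)))
    where
    by-parity : ∀ b → isEven (suc j) ≡ b → ∀ c →
      conv (W (suc j)) (if c then sprod (map zs is) else zS) w ≡ (if not b ∧ c then sprod (map zs (suc j ∷ is)) else zS) w
    by-parity true e c = trans (conv-cong (W-even (suc j) e) (λ _ → refl) w) (conv-zeroˡ _ w)
    by-parity false e true = conv-cong (W-odd (suc j) e) (λ _ → refl) w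
    by-parity false e false = trans (conv-cong (W-odd (suc j) e) (λ _ → refl) w) (conv-zeroʳ (zs (suc j)) w)

  π-eB : (I : CompB) → IsCompB I → π (eB ζ ζ̃ I) SymP.≈ (if isTwoPeak I then e2B z I else SymP.zeroP)
  π-eB (i₀ , is) hI w = begin
      cf (π (eB ζ ζ̃ (i₀ , is))) w
    ≡⟨ cong (λ p → cf p w) (π-· (invMult is) (ζ̃ i₀ MRP.⊗ MRP.prodP (map ζ is))) ⟩
      cf (invMult is SymP.· π (ζ̃ i₀ MRP.⊗ MRP.prodP (map ζ is))) w
    ≡⟨ coeff-· (invMult is) (π (ζ̃ i₀ MRP.⊗ MRP.prodP (map ζ is))) w ⟩
      invMult is Q.* cf (π (ζ̃ i₀ MRP.⊗ MRP.prodP (map ζ is))) w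
    ≡⟨ cong (invMult is Q.*_) (trans (cf-π-⊗ (ζ̃ i₀) (MRP.prodP (map ζ is)) w) (conv-cong (π-ζ̃-series i₀) image-prod w)) ⟩
      invMult is Q.* conv (if isEven i₀ then zs i₀ else zS) (if and (map (λ i → not (isEven i)) is) then sprod (map zs is) else zS) w
    ≡⟨ by-parity (isEven i₀) (and (map (λ i → not (isEven i)) is)) ⟩
      cf (if isEven i₀ ∧ and (map (λ i → not (isEven i)) is) then e2B z (i₀ , is) else SymP.zeroP) w
    ∎
    where
    open ≡-Reasoning
    image-prod : cf (π (MRP.prodP (map ζ is))) ≗ (if and (map (λ i → not (isEven i)) is) then sprod (map zs is) else zS)
    image-prod w' = trans (cong (λ p → cf p w') (trans (π-prodP (map ζ is)) (cong SymP.prodP (π-map ζ (π ∘ ζ) (λ _ → refl) is))))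
                          (trans (cf-prodP-map (π ∘ ζ) u (λ _ _ → refl) is w') (π-prod-ζ is hI w'))
    e2B-series : cf (e2B z (i₀ , is)) w ≡ invMult is Q.* conv (zs i₀) (sprod (map zs is)) w
    e2B-series = trans (coeff-· (invMult is) (z i₀ SymP.⊗ SymP.prodP (map z is)) w)
      (cong (invMult is Q.*_) (trans (cf-⊗ (z i₀) (SymP.prodP (map z is)) w) (conv-cong (λ _ → refl) (cf-prodP-map z zs (λ _ _ → refl) is) w)))
    by-parity : ∀ b c → invMult is Q.* conv (if b then zs i₀ else zS) (if c then sprod (map zs is) else zS) w
                      ≡ cf (if b ∧ c then e2B z (i₀ , is) else SymP.zeroP) w
    by-parity true true = sym e2B-series
    by-parity true false = trans (cong (invMult is Q.*_) (conv-zeroʳ (zs i₀) w)) (QP.*-zeroʳ (invMult is))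
    by-parity false c = trans (cong (invMult is Q.*_) (conv-zeroˡ (if c then sprod (map zs is) else zS) w)) (QP.*-zeroʳ (invMult is))

mainTheorem14 : (ζ ζ̃ : ℕ → MRPol) (z : ℕ → SymPol)
    → IsZeta ζ → IsZetaTilde ζ ζ̃ → IsZeta2 z
    → ((n : ℕ) → π (ζ (suc n)) SymP.≈ (if isEven (suc n) then SymP.zeroP else z (suc n)))
    × ((n : ℕ) → π (ζ̃ n) SymP.≈ (if isEven n then z n else SymP.zeroP))
    × ((I : CompB) → IsCompB I
    → π (eB ζ ζ̃ I) SymP.≈ (if isTwoPeak I then e2B z I else SymP.zeroP))
mainTheorem14 ζ ζ̃ z hζ hζ̃ hz = π-ζ , π-ζ̃ , π-eB
  where open Specialisation ζ ζ̃ z hζ hζ̃ hz
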